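{- Let $\mathcal C_n$ be the set of permutations in $\mathfrak S_n$ avoiding the generalized patterns $1\text{ - }2\text{ - }34$ and $2\text{ - }1\text{ - }3$, and let $H(t,u,v)=\sum_{n\ge1}\sum_{\pi\in\mathcal C_n}u^{m(\pi)}v^{\pi_n}t^n$. Then $$H(t,u,v)=\frac{tu^2v\left[1+(v-3)t+(1+u-v-uv+v^2)t^2+uv(1-v)t^3\right]}{(1-3t+t^2)(1-tu)}.$$
   Context: $\mathfrak S_n$ is the set of permutations $\pi=\pi_1\cdots\pi_n$ of $\{1,\dots,n\}$. $\pi$ avoids $2\text{ - }1\text{ - }3$ if there are no $i<j<k$ with $\pi_j<\pi_i<\pi_k$; $\pi$ avoids $1\text{ - }2\text{ - }34$ if there are no $i<j<k$ with $\pi_i<\pi_j<\pi_k<\pi_{k+1}$. For $\pi\in\mathfrak S_n$, $m(\pi)=n+1$ if $\pi=n(n-1)\cdots21$, and otherwise $m(\pi)=\min\{\pi_i:\exists j<i \text{ with } \pi_j<\pi_i\}$. -}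

module Defs where

open import Data.Bool using (Bool; true; false; if_then_else_; _∧_; _∨_; not)
open import Data.Nat as ℕ using (ℕ; zero; suc; _∸_; _⊓_; _<ᵇ_; _≡ᵇ_)
open import Data.Integer as ℤ using (ℤ; +_)
open import Data.List using (List; []; _∷_; upTo; concatMap; map; foldr; length; filter; reverse; downFrom)
open import Data.Bool.ListAction using (any)
open import Data.List.Properties using (≡-dec)
open import Relation.Nullary.Decidable using (⌊_⌋)
open import Relation.Binary.PropositionalEquality using (_≡_)

-- Permutations of {1,…,n}, written as lists π₁ ⋯ πₙ (one-line notation).

insertions : ℕ → List ℕ → List (List ℕ)
insertions x []       = (x ∷ []) ∷ []
insertions x (y ∷ ys) = (x ∷ y ∷ ys) ∷ map (y ∷_) (insertions x ys)

perms : ℕ → List (List ℕ)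
perms zero    = [] ∷ []
perms (suc n) = concatMap (insertions (suc n)) (perms n)

-- π at 0-based position i (so πᵢ in the paper is at π (i - 1))
at : List ℕ → ℕ → ℕ
at []       _       = 0
at (x ∷ xs) zero    = x
at (x ∷ xs) (suc i) = at xs i

contains-2-1-3 : List ℕ → Bool
contains-2-1-3 π =
  any (λ k → any (λ j → any (λ i →
      (at π j <ᵇ at π i) ∧ (at π i <ᵇ at π k)) (upTo j)) (upTo k)) (upTo (length π))

contains-1-2-34 : List ℕ → Bool
contains-1-2-34 π =
  any (λ k → any (λ j → any (λ i →
      (suc k <ᵇ length π) ∧ (at π i <ᵇ at π j) ∧ (at π j <ᵇ at π k)
        ∧ (at π k <ᵇ at π (suc k))) (upTo j)) (upTo k)) (upTo (length π))

inC : List ℕ → Bool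
inC π = not (contains-1-2-34 π) ∧ not (contains-2-1-3 π)

ascTops : List ℕ → List ℕ
ascTops π = map (at π)
  (filter (λ i → any? i) (upTo (length π)))
  where
  open import Relation.Nullary.Decidable using (Dec; yes; no)
  open import Data.Bool using (T)
  open import Data.Bool.Properties using (T?)
  any? : (i : ℕ) → Dec (T (any (λ j → at π j <ᵇ at π i) (upTo i)))
  any? i = T? _

decreasing : ℕ → List ℕ
decreasing n = map suc (downFrom n)

m : List ℕ → ℕ
m π = if ⌊ ≡-dec ℕ._≟_ π (decreasing (length π)) ⌋
        then suc (length π)
        else foldr _⊓_ (suc (length π)) (ascTops π)

lastEntry : List ℕ → ℕ
lastEntry π = at π (length π ∸ 1)

-- Formal power series in t, u, v with integer coefficients:
-- f n a b is the coefficient of tⁿ uᵃ vᵇ.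

FPS : Set
FPS = ℕ → ℕ → ℕ → ℤ

Σ≤ : ℕ → (ℕ → ℤ) → ℤ
Σ≤ n f = foldr (λ i acc → f i ℤ.+ acc) (+ 0) (upTo (suc n))

infixl 6 _⊕_ _⊖_
infixl 7 _⊛_

_⊕_ : FPS → FPS → FPS
(f ⊕ g) n a b = f n a b ℤ.+ g n a b

_⊖_ : FPS → FPS → FPS
(f ⊖ g) n a b = f n a b ℤ.- g n a b

_⊛_ : FPS → FPS → FPS
(f ⊛ g) n a b =
  Σ≤ n λ i → Σ≤ a λ j → Σ≤ b λ k → f i j k ℤ.* g (n ∸ i) (a ∸ j) (b ∸ k)

const : ℤ → FPS
const c zero zero zero = c
const c _    _    _    = + 0

T U V : FPS
T 1 0 0 = + 1
T _ _ _ = + 0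
U 0 1 0 = + 1
U _ _ _ = + 0
V 0 0 1 = + 1
V _ _ _ = + 0

_≈_ : FPS → FPS → Set
f ≈ g = ∀ n a b → f n a b ≡ g n a b

H : FPS
H zero    a b = + 0
H (suc n) a b = + length (filter (λ π → T? (inC π ∧ (m π ≡ᵇ a) ∧ (lastEntry π ≡ᵇ b))) (perms (suc n)))
  where
  open import Data.Bool.Properties using (T?)

numerator : FPS
numerator = T ⊛ U ⊛ U ⊛ V ⊛
  ( const (+ 1)
  ⊕ (V ⊖ const (+ 3)) ⊛ T
  ⊕ (const (+ 1) ⊕ U ⊖ V ⊖ U ⊛ V ⊕ V ⊛ V) ⊛ T ⊛ T
  ⊕ U ⊛ V ⊛ (const (+ 1) ⊖ V) ⊛ T ⊛ T ⊛ T )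

denominator : FPS
denominator = (const (+ 1) ⊖ const (+ 3) ⊛ T ⊕ T ⊛ T) ⊛ (const (+ 1) ⊖ T ⊛ U)

module Submission where

-- For n ≥ 3, an insertion at a position ≥ 3 always creates 2-1-3 or 1-2-34, while insertions
-- at positions 0 and 1 keep membership in 𝒞, and position 2 keeps it exactly when σ starts
-- with an ascent. These children keep the last entry and keep m, except that prepending n+1
-- to the decreasing σ raises m = n+1 to n+2. Counting children gives recurrences for
-- h(n,a,b) = #{π ∈ 𝒞ₙ : m(π) = a, πₙ = b}; eliminating the auxiliary count of those π that
-- start with an ascent, h(n+2) − 3h(n+1) + h(n) equals a correction supported on
-- a ∈ {n+1, n+2, n+3} that is invariant under (n, a) ↦ (n+1, a+1). Therefore the coefficient
-- of tⁿ in H · (1 − 3t + t²)(1 − tu) vanishes for n ≥ 6, as does that of the numerator.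
--
-- Numerator and denominator are expanded into explicit lists of monomials;
-- multiplying H by a polynomial sums shifted copies of H. For t-degree ≤ 5 both sides vanish
-- outside u-degree < 8, v-degree < 6, and the remaining coefficients are compared by computation.

open import Defs

module BooleanTests where

  open import Data.Bool using (Bool; true; false) renaming (T to IsTrue)
  open import Data.Bool.Properties using (T-≡)
  open import Data.Empty using (⊥-elim)
  open import Data.Nat using (_≤_; _<ᵇ_; _≡ᵇ_)
  open import Data.Nat.Properties using (≡ᵇ⇒≡; ≡⇒≡ᵇ; <ᵇ⇒<; <⇒≱)
  open import Function.Bundles using (Equivalence)
  open import Relation.Binary.PropositionalEquality

  bool-ext : ∀ {a b : Bool} → (IsTrue a → IsTrue b) → (IsTrue b → IsTrue a) → a ≡ b
  bool-ext {false} {false} _ _ = refl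
  bool-ext {false} {true}  _ g = ⊥-elim (g _)
  bool-ext {true}  {false} f _ = ⊥-elim (f _)
  bool-ext {true}  {true}  _ _ = refl

  <ᵇ-false : ∀ {x y} → y ≤ x → (x <ᵇ y) ≡ false
  <ᵇ-false {x} {y} y≤x with x <ᵇ y in lt
  ... | false = refl
  ... | true  = ⊥-elim (<⇒≱ (<ᵇ⇒< x y (Equivalence.from T-≡ lt)) y≤x)

  ≡ᵇ-false : ∀ x y → x ≢ y → (x ≡ᵇ y) ≡ false
  ≡ᵇ-false x y x≢y with x ≡ᵇ y in eq
  ... | false = refl
  ... | true  = ⊥-elim (x≢y (≡ᵇ⇒≡ x y (Equivalence.from T-≡ eq)))

  ≡ᵇ-refl : ∀ x → (x ≡ᵇ x) ≡ true
  ≡ᵇ-refl x = Equivalence.to T-≡ (≡⇒≡ᵇ x x refl)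

module Permutations where

  open import Data.Bool using (Bool; true; false; not; _∧_; if_then_else_) renaming (T to IsTrue)
  open import Data.Bool.Properties using (T?; T-∧; T-≡; ∧-zeroʳ; ∧-identityʳ; ∧-assoc; ∧-idem)
  open import Data.Bool.ListAction using (any)
  open import Data.Empty using (⊥; ⊥-elim)
  open import Data.Integer using (+_)
  open import Data.List using (List; []; _∷_; length; map; filter; upTo; downFrom; foldr; concatMap; _++_)
  open import Data.List.Properties using (foldr-preservesᵒ; filter-none; length-map; length-downFrom; ≡-dec)
  open import Data.List.Membership.Propositional using (_∈_; find; lose)
  open import Data.List.Membership.Propositional.Properties
    using (∈-upTo⁺; ∈-upTo⁻; ∈-map⁺; ∈-map⁻; ∈-filter⁺; ∈-filter⁻; ∈-concatMap⁻; foldr-selective)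
  open import Data.List.Relation.Unary.All as All using (All)
  open import Data.List.Relation.Unary.Any as Any using (Any)
  open import Data.List.Relation.Unary.Any using (here; there)
  open import Data.List.Relation.Unary.Any.Properties using (any⁺; any⁻)
  open import Data.Nat
    using (ℕ; zero; suc; pred; >-nonZero; _+_; _∸_; _⊓_; _≤_; _<_; _<ᵇ_; _≡ᵇ_; z≤n; s≤s; z<s; _≟_)
  open import Data.Nat.Properties
  open import Data.Nat.Tactic.RingSolver using (solve-∀)
  open import Data.Product using (∃; ∃-syntax; _×_; _,_; proj₁)
  open import Data.Sum using (_⊎_; inj₁; inj₂; [_,_])
  open import Function.Base using (_∘_)
  open import Function.Bundles using (Equivalence)
  open import Relation.Binary.Definitions using (Tri; tri<; tri≈; tri>)
  open import Relation.Binary.PropositionalEquality hiding ([_])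
  open import Relation.Nullary using (¬_; yes; no)

  open BooleanTests

  anyUpTo⁺ : ∀ (f : ℕ → Bool) n {i} → i < n → IsTrue (f i) → IsTrue (any f (upTo n))
  anyUpTo⁺ f n i<n fi = any⁺ f (lose (∈-upTo⁺ i<n) fi)

  anyUpTo⁻ : ∀ (f : ℕ → Bool) n → IsTrue (any f (upTo n)) → ∃ λ i → i < n × IsTrue (f i)
  anyUpTo⁻ f n t = let i , i∈ , fi = find (any⁻ f (upTo n) t) in i , ∈-upTo⁻ i∈ , fi

  Occ213 : List ℕ → ℕ → ℕ → ℕ → Set
  Occ213 π i j k = i < j × j < k × k < length π × at π j < at π i × at π i < at π k

  Occ1234 : List ℕ → ℕ → ℕ → ℕ → Set
  Occ1234 π i j k =
    i < j × j < k × suc k < length π × at π i < at π j × at π j < at π k × at π k < at π (suc k)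

  Contains213 Contains1234 : List ℕ → Set
  Contains213  π = ∃[ i ] ∃[ j ] ∃[ k ] Occ213 π i j k
  Contains1234 π = ∃[ i ] ∃[ j ] ∃[ k ] Occ1234 π i j k

  contains213⁺ : ∀ π → Contains213 π → IsTrue (contains-2-1-3 π)
  contains213⁺ π (i , j , k , i<j , j<k , k<n , ji , ik) =
    anyUpTo⁺ _ _ k<n (anyUpTo⁺ _ _ j<k (anyUpTo⁺ _ _ i<j
      (Equivalence.from T-∧ (<⇒<ᵇ ji , <⇒<ᵇ ik))))

  contains213⁻ : ∀ π → IsTrue (contains-2-1-3 π) → Contains213 π
  contains213⁻ π t =
    let k , k<n , t₁ = anyUpTo⁻ _ (length π) t
        j , j<k , t₂ = anyUpTo⁻ _ k t₁
        i , i<j , t₃ = anyUpTo⁻ _ j t₂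
        ji , ik      = Equivalence.to T-∧ t₃
    in i , j , k , i<j , j<k , k<n , <ᵇ⇒< _ _ ji , <ᵇ⇒< _ _ ik

  contains1234⁺ : ∀ π → Contains1234 π → IsTrue (contains-1-2-34 π)
  contains1234⁺ π (i , j , k , i<j , j<k , k+1<n , ij , jk , kk+1) =
    anyUpTo⁺ _ _ (<-trans (n<1+n k) k+1<n) (anyUpTo⁺ _ _ j<k (anyUpTo⁺ _ _ i<j
      (Equivalence.from T-∧ (<⇒<ᵇ k+1<n , Equivalence.from T-∧ (<⇒<ᵇ ij ,
        Equivalence.from T-∧ (<⇒<ᵇ jk , <⇒<ᵇ kk+1))))))

  contains1234⁻ : ∀ π → IsTrue (contains-1-2-34 π) → Contains1234 π
  contains1234⁻ π t =
    let k , _ , t₁       = anyUpTo⁻ _ (length π) t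
        j , j<k , t₂     = anyUpTo⁻ _ k t₁
        i , i<j , t₃     = anyUpTo⁻ _ j t₂
        k+1<n , t₄       = Equivalence.to T-∧ t₃
        ij , t₅          = Equivalence.to T-∧ t₄
        jk , kk+1        = Equivalence.to T-∧ t₅
    in i , j , k , i<j , j<k , <ᵇ⇒< _ _ k+1<n , <ᵇ⇒< _ _ ij , <ᵇ⇒< _ _ jk , <ᵇ⇒< _ _ kk+1

  ∉C-213 : ∀ π → Contains213 π → inC π ≡ false
  ∉C-213 π occ rewrite Equivalence.to T-≡ (contains213⁺ π occ) = ∧-zeroʳ _

  ∉C-1234 : ∀ π → Contains1234 π → inC π ≡ false
  ∉C-1234 π occ rewrite Equivalence.to T-≡ (contains1234⁺ π occ) = refl

  insertAt : ℕ → ℕ → List ℕ → List ℕ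
  insertAt zero    x σ       = x ∷ σ
  insertAt (suc p) x []      = x ∷ []
  insertAt (suc p) x (s ∷ σ) = s ∷ insertAt p x σ

  -- The position in insertAt p x σ of the entry at position i of σ.
  skip : ℕ → ℕ → ℕ
  skip zero    i       = suc i
  skip (suc p) zero    = zero
  skip (suc p) (suc i) = suc (skip p i)

  length-insertAt : ∀ p x σ → length (insertAt p x σ) ≡ suc (length σ)
  length-insertAt zero    x σ       = refl
  length-insertAt (suc p) x []      = refl
  length-insertAt (suc p) x (s ∷ σ) = cong suc (length-insertAt p x σ)

  at-insertAt : ∀ p x σ → p ≤ length σ → at (insertAt p x σ) p ≡ x
  at-insertAt zero    x σ       _         = refl
  at-insertAt (suc p) x (s ∷ σ) (s≤s p≤) = at-insertAt p x σ p≤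

  at-skip : ∀ p x σ i → p ≤ length σ → at (insertAt p x σ) (skip p i) ≡ at σ i
  at-skip zero    x σ       i       _         = refl
  at-skip (suc p) x (s ∷ σ) zero    _         = refl
  at-skip (suc p) x (s ∷ σ) (suc i) (s≤s p≤) = at-skip p x σ i p≤

  skip-below : ∀ p i → i < p → skip p i ≡ i
  skip-below (suc p) zero    _         = refl
  skip-below (suc p) (suc i) (s≤s i<p) = cong suc (skip-below p i i<p)

  skip-above : ∀ p i → p ≤ i → skip p i ≡ suc i
  skip-above zero    i       _         = refl
  skip-above (suc p) (suc i) (s≤s p≤i) = cong suc (skip-above p i p≤i)

  skip-suc : ∀ p k → p ≤ k → skip p (suc k) ≡ suc (skip p k)
  skip-suc p k p≤k = trans (skip-above p (suc k) (m≤n⇒m≤1+n p≤k)) (cong suc (sym (skip-above p k p≤k)))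

  skip-at-least⁻ : ∀ p k → p ≤ skip p k → p ≤ k
  skip-at-least⁻ zero    k       _        = z≤n
  skip-at-least⁻ (suc p) (suc k) (s≤s le) = s≤s (skip-at-least⁻ p k le)

  skip-mono : ∀ p {i j} → i < j → skip p i < skip p j
  skip-mono zero                    i<j       = s≤s i<j
  skip-mono (suc p) {zero}  {suc j} _         = z<s
  skip-mono (suc p) {suc i} {suc j} (s≤s i<j) = s≤s (skip-mono p i<j)

  skip-reflect : ∀ p {i j} → skip p i < skip p j → i < j
  skip-reflect zero                    (s≤s i<j) = i<j
  skip-reflect (suc p) {zero}  {suc j} _         = z<s
  skip-reflect (suc p) {suc i} {suc j} (s≤s lt)  = s≤s (skip-reflect p lt)

  skip-onto : ∀ p t → t ≢ p → ∃ λ i → skip p i ≡ t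
  skip-onto zero    zero    t≢p = ⊥-elim (t≢p refl)
  skip-onto zero    (suc t) _   = t , refl
  skip-onto (suc p) zero    _   = zero , refl
  skip-onto (suc p) (suc t) t≢p =
    let i , eq = skip-onto p t (t≢p ∘ cong suc) in suc i , cong suc eq

  skip-bound : ∀ p i {n} → i < n → skip p i < suc n
  skip-bound zero    i       i<n       = s≤s i<n
  skip-bound (suc p) zero    i<n       = z<s
  skip-bound (suc p) (suc i) (s≤s i<n) = s≤s (skip-bound p i i<n)

  skip-bound⁻ : ∀ p i {n} → p ≤ n → skip p i < suc n → i < n
  skip-bound⁻ zero    i       _         (s≤s i<n) = i<n
  skip-bound⁻ (suc p) zero    (s≤s _)   _         = z<s
  skip-bound⁻ (suc p) (suc i) (s≤s p≤n) (s≤s lt)  = s≤s (skip-bound⁻ p i p≤n lt)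

  -- No entry of σ exceeds n ('at' returns 0 outside σ).
  Bounded : ℕ → List ℕ → Set
  Bounded n σ = ∀ t → at σ t ≤ n

  Distinct : List ℕ → Set
  Distinct σ = ∀ {i j} → i < length σ → j < length σ → at σ i ≡ at σ j → i ≡ j

  IsPerm : ℕ → List ℕ → Set
  IsPerm n σ = length σ ≡ n × Bounded n σ × Distinct σ

  bounded-insertAt : ∀ p n σ → Bounded n σ → Bounded (suc n) (insertAt p (suc n) σ)
  bounded-insertAt zero    n σ       bnd zero    = ≤-refl
  bounded-insertAt zero    n σ       bnd (suc t) = m≤n⇒m≤1+n (bnd t)
  bounded-insertAt (suc p) n []      bnd zero    = ≤-refl
  bounded-insertAt (suc p) n []      bnd (suc t) = z≤n
  bounded-insertAt (suc p) n (s ∷ σ) bnd zero    = m≤n⇒m≤1+n (bnd 0)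
  bounded-insertAt (suc p) n (s ∷ σ) bnd (suc t) = bounded-insertAt p n σ (bnd ∘ suc) t

  at-insertAt-other : ∀ p x σ t n → p ≤ length σ → Bounded n σ → t ≢ p →
                      at (insertAt p x σ) t ≤ n
  at-insertAt-other p x σ t n p≤ bnd t≢p with skip-onto p t t≢p
  ... | i , refl = subst (_≤ n) (sym (at-skip p x σ i p≤)) (bnd i)

  distinct-insertAt : ∀ p n σ → p ≤ length σ → Bounded n σ → Distinct σ →
                      Distinct (insertAt p (suc n) σ)
  distinct-insertAt p n σ p≤ bnd dst {i} {j} i< j< eq with i ≟ p | j ≟ p
  ... | yes refl | yes refl = refl
  ... | yes refl | no j≢p   = ⊥-elim (1+n≰n (subst (_≤ n) (trans (sym eq) (at-insertAt p (suc n) σ p≤))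
                                         (at-insertAt-other p (suc n) σ j n p≤ bnd j≢p)))
  ... | no i≢p   | yes refl = ⊥-elim (1+n≰n (subst (_≤ n) (trans eq (at-insertAt p (suc n) σ p≤))
                                         (at-insertAt-other p (suc n) σ i n p≤ bnd i≢p)))
  ... | no i≢p   | no j≢p   with skip-onto p i i≢p | skip-onto p j j≢p
  ...   | i′ , refl | j′ , refl =
    cong (skip p) (dst (old i′ i<) (old j′ j<)
      (trans (sym (at-skip p (suc n) σ i′ p≤)) (trans eq (at-skip p (suc n) σ j′ p≤))))
    where
    old : ∀ i′ → skip p i′ < length (insertAt p (suc n) σ) → i′ < length σ
    old i′ lt = skip-bound⁻ p i′ p≤ (subst (skip p i′ <_) (length-insertAt p (suc n) σ) lt)

  ∈-insertions⁻ : ∀ x σ {ρ} → ρ ∈ insertions x σ → ∃ λ p → p ≤ length σ × ρ ≡ insertAt p x σ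
  ∈-insertions⁻ x []      (here refl) = 0 , z≤n , refl
  ∈-insertions⁻ x (y ∷ σ) (here refl) = 0 , z≤n , refl
  ∈-insertions⁻ x (y ∷ σ) (there ρ∈) with ∈-map⁻ (y ∷_) ρ∈
  ... | ρ′ , ρ′∈ , refl with ∈-insertions⁻ x σ ρ′∈
  ...   | p , p≤ , refl = suc p , s≤s p≤ , refl

  perms-IsPerm : ∀ n {σ} → σ ∈ perms n → IsPerm n σ
  perms-IsPerm zero (here refl) = refl , (λ _ → z≤n) , λ ()
  perms-IsPerm (suc n) σ∈ with find (∈-concatMap⁻ (insertions (suc n)) {xs = perms n} σ∈)
  ... | τ , τ∈ , σ∈ins with perms-IsPerm n τ∈ | ∈-insertions⁻ (suc n) τ σ∈ins
  ...   | len , bnd , dst | p , p≤ , refl =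
    trans (length-insertAt p (suc n) τ) (cong suc len) ,
    bounded-insertAt p n τ bnd ,
    distinct-insertAt p n τ p≤ bnd dst

  IncreasingBefore : ℕ → List ℕ → Set
  IncreasingBefore p σ = ∀ {i j} → i < j → j < p → at σ i < at σ j

  two≤k : ∀ {i j k} → i < j → j < k → 2 ≤ k
  two≤k i<j j<k = ≤-trans (s≤s (≤-trans z<s i<j)) j<k

  module InsertMaximum (n p : ℕ) (σ : List ℕ) (p≤ : p ≤ length σ) (bnd : Bounded n σ) where

    π : List ℕ
    π = insertAt p (suc n) σ

    length-π : length π ≡ suc (length σ)
    length-π = length-insertAt p (suc n) σ

    at-π-skip : ∀ i → at π (skip p i) ≡ at σ i
    at-π-skip i = at-skip p (suc n) σ i p≤

    at-π-before : ∀ t → t < p → at π t ≡ at σ t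
    at-π-before t t<p = trans (cong (at π) (sym (skip-below p t t<p))) (at-π-skip t)

    at-π-new : at π p ≡ suc n
    at-π-new = at-insertAt p (suc n) σ p≤

    skip-inside : ∀ {i} → i < length σ → skip p i < length π
    skip-inside {i} i< = subst (skip p i <_) (sym length-π) (skip-bound p i i<)

    skip-inside⁻ : ∀ {i} → skip p i < length π → i < length σ
    skip-inside⁻ {i} lt = skip-bound⁻ p i p≤ (subst (skip p i <_) length-π lt)

    below-is-old : ∀ {t u} → at π t < at π u → t ≢ p
    below-is-old {t} {u} lt refl =
      1+n≰n (≤-trans (subst (_< at π u) at-π-new lt) (bounded-insertAt p n σ bnd u))

    occ213⁺ : ∀ {i j k} → Occ213 σ i j k → Occ213 π (skip p i) (skip p j) (skip p k)
    occ213⁺ {i} {j} {k} (i<j , j<k , k< , ji , ik) =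
      skip-mono p i<j , skip-mono p j<k , skip-inside k< ,
      subst₂ _<_ (sym (at-π-skip j)) (sym (at-π-skip i)) ji ,
      subst₂ _<_ (sym (at-π-skip i)) (sym (at-π-skip k)) ik

    -- If σ increases before p, the maximum cannot serve as the '3' of a 2-1-3; as '2' or '1'
    -- it would have to lie below another entry.
    occ213⁻ : IncreasingBefore p σ → ∀ {i j k} → Occ213 π i j k → Contains213 σ
    occ213⁻ inc {i} {j} {k} (i<j , j<k , k< , ji , ik)
      with skip-onto p i (below-is-old ik) | skip-onto p j (below-is-old ji) | skip-onto p k k≢p
      where
      k≢p : k ≢ p
      k≢p refl = <-asym (inc i<j j<k)
        (subst₂ _<_ (at-π-before j j<k) (at-π-before i (<-trans i<j j<k)) ji)
    ... | i′ , refl | j′ , refl | k′ , refl =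
      i′ , j′ , k′ , skip-reflect p i<j , skip-reflect p j<k , skip-inside⁻ k< ,
      subst₂ _<_ (at-π-skip j′) (at-π-skip i′) ji ,
      subst₂ _<_ (at-π-skip i′) (at-π-skip k′) ik

    contains213-insert : IncreasingBefore p σ → contains-2-1-3 π ≡ contains-2-1-3 σ
    contains213-insert inc = bool-ext
      (λ t → let _ , _ , _ , occ = contains213⁻ π t in contains213⁺ σ (occ213⁻ inc occ))
      (λ t → let _ , _ , _ , occ = contains213⁻ σ t in contains213⁺ π (_ , _ , _ , occ213⁺ occ))

    -- For p ≤ 2 the adjacent pair k, k+1 of an occurrence in σ (k ≥ 2) stays adjacent in π.
    occ1234⁺ : p ≤ 2 → ∀ {i j k} → Occ1234 σ i j k → Occ1234 π (skip p i) (skip p j) (skip p k)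
    occ1234⁺ p≤2 {i} {j} {k} (i<j , j<k , k+1< , ij , jk , kk+1) =
      skip-mono p i<j , skip-mono p j<k ,
      subst (_< length π) next (skip-inside k+1<) ,
      subst₂ _<_ (sym (at-π-skip i)) (sym (at-π-skip j)) ij ,
      subst₂ _<_ (sym (at-π-skip j)) (sym (at-π-skip k)) jk ,
      subst₂ _<_ (sym (at-π-skip k)) (trans (sym (at-π-skip (suc k))) (cong (at π) next)) kk+1
      where
      next : skip p (suc k) ≡ suc (skip p k)
      next = skip-suc p k (≤-trans p≤2 (two≤k i<j j<k))

    -- For p ≤ 2 the maximum can neither serve as the '4' nor separate the adjacent '34'.
    occ1234⁻ : p ≤ 2 → ∀ {i j k} → Occ1234 π i j k → Contains1234 σ
    occ1234⁻ p≤2 {i} {j} {k} (i<j , j<k , k+1< , ij , jk , kk+1)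
      with skip-onto p i (below-is-old ij) | skip-onto p j (below-is-old jk)
         | skip-onto p k (below-is-old kk+1)
    ... | i′ , refl | j′ , refl | k′ , refl =
      i′ , j′ , k′ , skip-reflect p i<j , skip-reflect p j<k ,
      skip-inside⁻ (subst (_< length π) (sym next) k+1<) ,
      subst₂ _<_ (at-π-skip i′) (at-π-skip j′) ij ,
      subst₂ _<_ (at-π-skip j′) (at-π-skip k′) jk ,
      subst₂ _<_ (at-π-skip k′) (trans (cong (at π) (sym next)) (at-π-skip (suc k′))) kk+1
      where
      next : skip p (suc k′) ≡ suc (skip p k′)
      next = skip-suc p k′ (skip-at-least⁻ p k′ (≤-trans p≤2 (two≤k i<j j<k)))

    contains1234-insert : p ≤ 2 → contains-1-2-34 π ≡ contains-1-2-34 σ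
    contains1234-insert p≤2 = bool-ext
      (λ t → let _ , _ , _ , occ = contains1234⁻ π t in contains1234⁺ σ (occ1234⁻ p≤2 occ))
      (λ t → let _ , _ , _ , occ = contains1234⁻ σ t in contains1234⁺ π (_ , _ , _ , occ1234⁺ p≤2 occ))

    inC-insert : p ≤ 2 → IncreasingBefore p σ → inC π ≡ inC σ
    inC-insert p≤2 inc =
      cong₂ (λ c₁ c₂ → not c₁ ∧ not c₂) (contains1234-insert p≤2) (contains213-insert inc)

    -- After a descent σ₁ > σ₂, the maximum completes a 2-1-3.
    inC-after-descent : 2 ≤ p → at σ 1 < at σ 0 → inC π ≡ false
    inC-after-descent 2≤p desc = ∉C-213 π (0 , 1 , p , z<s , 2≤p , subst (p <_) (sym length-π) (s≤s p≤) ,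
      subst₂ _<_ (sym (at-π-before 1 2≤p)) (sym (at-π-before 0 (≤-trans z<s 2≤p))) desc ,
      subst₂ _<_ (sym (at-π-before 0 (≤-trans z<s 2≤p))) (sym at-π-new) (s≤s (bnd 0)))

    inC-late : 3 ≤ p → Distinct σ → inC π ≡ false
    inC-late 3≤p dst = by-cases (<-cmp (at σ 0) (at σ 1)) (<-cmp (at σ q) (at σ 1))
      where
      q : ℕ
      q = pred p
      2≤q : 2 ≤ q
      2≤q = <⇒≤pred 3≤p
      q<p : q < p
      q<p = subst (q <_) (suc-pred p {{>-nonZero (≤-trans z<s 3≤p)}}) (n<1+n q)
      p<π : p < length π
      p<π = subst (p <_) (sym length-π) (s≤s p≤)
      inside : ∀ {t} → t < p → t < length σ
      inside t<p = <-≤-trans t<p p≤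
      0<p : 0 < p
      0<p = ≤-trans z<s 3≤p
      1<p : 1 < p
      1<p = ≤-trans (s≤s z<s) 3≤p
      new-above : ∀ t → at σ t < at π p
      new-above t = subst (at σ t <_) (sym at-π-new) (s≤s (bnd t))

      by-cases : Tri (at σ 0 < at σ 1) (at σ 0 ≡ at σ 1) (at σ 1 < at σ 0) →
                 Tri (at σ q < at σ 1) (at σ q ≡ at σ 1) (at σ 1 < at σ q) → inC π ≡ false
      -- σ₁ > σ₂: the maximum completes 2-1-3
      by-cases (tri> _ _ desc) _ = inC-after-descent (≤-trans (n≤1+n 2) 3≤p) desc
      by-cases (tri≈ _ eq _)   _ = case (dst (inside 0<p) (inside 1<p) eq)
        where
        case : 0 ≡ 1 → inC π ≡ false
        case ()
      -- σ₁ < σ₂ and σ_q < σ₂ (q = p-1): positions 1, q, p carry 2-1-3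
      by-cases (tri< _ _ _) (tri< lt _ _) = ∉C-213 π (1 , q , p , 2≤q , q<p , p<π ,
        subst₂ _<_ (sym (at-π-before q q<p)) (sym (at-π-before 1 1<p)) lt ,
        subst (_< at π p) (sym (at-π-before 1 1<p)) (new-above 1))
      by-cases (tri< _ _ _) (tri≈ _ eq _) =
        ⊥-elim (<-irrefl (sym (dst (inside q<p) (inside 1<p) eq)) 2≤q)
      -- σ₁ < σ₂ < σ_q: positions 0, 1, q, q+1 = p carry 1-2-34
      by-cases (tri< asc _ _) (tri> _ _ gt) = ∉C-1234 π (0 , 1 , q , z<s , 2≤q ,
        subst (_< length π) (sym q+1≡p) p<π ,
        subst₂ _<_ (sym (at-π-before 0 0<p)) (sym (at-π-before 1 1<p)) asc ,
        subst₂ _<_ (sym (at-π-before 1 1<p)) (sym (at-π-before q q<p)) gt ,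
        subst₂ _<_ (sym (at-π-before q q<p)) (cong (at π) (sym q+1≡p)) (new-above q))
        where
        q+1≡p : suc q ≡ p
        q+1≡p = suc-pred p {{>-nonZero 0<p}}

    lastEntry-insert : p < length σ → lastEntry π ≡ lastEntry σ
    lastEntry-insert p<len = begin
      at π (length π ∸ 1)          ≡⟨ cong (λ l → at π (l ∸ 1)) length-π ⟩
      at π (length σ)              ≡⟨ cong (at π) (sym skip-last) ⟩
      at π (skip p (length σ ∸ 1)) ≡⟨ at-π-skip (length σ ∸ 1) ⟩
      at σ (length σ ∸ 1)          ∎
      where
      open ≡-Reasoning
      skip-last : skip p (length σ ∸ 1) ≡ length σ
      skip-last = trans (skip-above p _ (<⇒≤pred p<len))
                        (suc-pred (length σ) {{>-nonZero (≤-<-trans z≤n p<len)}})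

  IsAscentTop : List ℕ → ℕ → Bool
  IsAscentTop π t = any (λ j → at π j <ᵇ at π t) (upTo t)

  mMin : List ℕ → ℕ
  mMin π = foldr _⊓_ (suc (length π)) (ascTops π)

  ∈-ascTops⁺ : ∀ π {t} → t < length π → IsTrue (IsAscentTop π t) → at π t ∈ ascTops π
  ∈-ascTops⁺ π t< top = ∈-map⁺ (at π) (∈-filter⁺ (λ i → T? (IsAscentTop π i)) (∈-upTo⁺ t<) top)

  ∈-ascTops⁻ : ∀ π {v} → v ∈ ascTops π →
               ∃ λ t → t < length π × IsTrue (IsAscentTop π t) × v ≡ at π t
  ∈-ascTops⁻ π v∈ with ∈-map⁻ (at π) v∈
  ... | t , t∈ , refl with ∈-filter⁻ (λ i → T? (IsAscentTop π i)) t∈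
  ...   | t∈upTo , top = t , ∈-upTo⁻ t∈upTo , top , refl

  foldr⊓≤ : ∀ {v} d L → d ≤ v ⊎ Any (_≤ v) L → foldr _⊓_ d L ≤ v
  foldr⊓≤ = foldr-preservesᵒ (λ x y → [ ≤-trans (m⊓n≤m x y) , ≤-trans (m⊓n≤n x y) ])

  mMin≤default : ∀ π → mMin π ≤ suc (length π)
  mMin≤default π = foldr⊓≤ _ (ascTops π) (inj₁ ≤-refl)

  mMin≤top : ∀ π {t} → t < length π → IsTrue (IsAscentTop π t) → mMin π ≤ at π t
  mMin≤top π t< top =
    foldr⊓≤ _ (ascTops π) (inj₂ (Any.map (≤-reflexive ∘ sym) (∈-ascTops⁺ π t< top)))

  mMin-attained : ∀ π → mMin π ≡ suc (length π) ⊎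
                   ∃ λ t → t < length π × IsTrue (IsAscentTop π t) × mMin π ≡ at π t
  mMin-attained π with foldr-selective ⊓-sel (suc (length π)) (ascTops π)
  ... | inj₁ eq = inj₁ eq
  ... | inj₂ m∈ = inj₂ (∈-ascTops⁻ π m∈)

  ascTops-decreasing : ∀ k → ascTops (decreasing k) ≡ []
  ascTops-decreasing k =
    cong (map (at π)) (filter-none (λ i → T? (IsAscentTop π i)) (All.tabulate no-top))
    where
    π = decreasing k
    at-decreasing : ∀ k i → i < k → at (decreasing k) i ≡ k ∸ i
    at-decreasing (suc k) zero    _         = refl
    at-decreasing (suc k) (suc i) (s≤s i<k) = at-decreasing k i i<k
    no-top : ∀ {t} → t ∈ upTo (length π) → ¬ IsTrue (IsAscentTop π t)
    no-top {t} t∈ top =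
      let j , j<t , lt = anyUpTo⁻ _ t top
          t<k = subst (t <_) (trans (length-map suc (downFrom k)) (length-downFrom k)) (∈-upTo⁻ t∈)
      in <⇒≱ (subst₂ _<_ (at-decreasing k j (<-trans j<t t<k)) (at-decreasing k t t<k) (<ᵇ⇒< _ _ lt))
             (∸-monoʳ-≤ k (<⇒≤ j<t))

  -- The decreasing permutation has no ascent tops, so m is always this minimum.
  m≡mMin : ∀ π → m π ≡ mMin π
  m≡mMin π with ≡-dec _≟_ π (decreasing (length π))
  ... | yes π≡dec = sym (cong (foldr _⊓_ (suc (length π)))
                           (trans (cong ascTops π≡dec) (ascTops-decreasing (length π))))
  ... | no _ = refl

  m≤ : ∀ π → m π ≤ suc (length π)
  m≤ π = subst (_≤ suc (length π)) (sym (m≡mMin π)) (mMin≤default π)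

  module InsertTop (p : ℕ) (σ : List ℕ) (p≤ : p ≤ length σ) (bnd : Bounded (length σ) σ) where

    open InsertMaximum (length σ) p σ p≤ bnd

    top⁺ : ∀ t → IsTrue (IsAscentTop σ t) → IsTrue (IsAscentTop π (skip p t))
    top⁺ t top = let j , j<t , lt = anyUpTo⁻ _ t top in
      anyUpTo⁺ _ _ (skip-mono p j<t) (<⇒<ᵇ (subst₂ _<_ (sym (at-π-skip j)) (sym (at-π-skip t)) (<ᵇ⇒< _ _ lt)))

    top⁻ : ∀ t → IsTrue (IsAscentTop π (skip p t)) → IsTrue (IsAscentTop σ t)
    top⁻ t top with anyUpTo⁻ _ (skip p t) top
    ... | j , j< , lt with skip-onto p j (below-is-old (<ᵇ⇒< _ _ lt))
    ...   | j′ , refl = anyUpTo⁺ _ _ (skip-reflect p j<)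
            (<⇒<ᵇ (subst₂ _<_ (at-π-skip j′) (at-π-skip t) (<ᵇ⇒< _ _ lt)))

    -- Every ascent top of π is the new maximum or an ascent top of σ, so mMin cannot drop.
    mMin-grows : mMin σ ≤ mMin π
    mMin-grows with mMin-attained π
    ... | inj₁ eq = ≤-trans (mMin≤default σ)
                      (subst (suc (length σ) ≤_) (sym (trans eq (cong suc length-π))) (n≤1+n _))
    ... | inj₂ (t , t< , top , eq) with t ≟ p
    ...   | yes refl = subst (mMin σ ≤_) (sym (trans eq at-π-new)) (mMin≤default σ)
    ...   | no t≢p with skip-onto p t t≢p
    ...     | t′ , refl = subst (mMin σ ≤_) (sym (trans eq (at-π-skip t′)))
                            (mMin≤top σ (skip-inside⁻ t<) (top⁻ t′ top))

    mMin≤old-top : ∀ t → t < length σ → IsTrue (IsAscentTop σ t) → mMin π ≤ at σ t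
    mMin≤old-top t t< top =
      subst (mMin π ≤_) (at-π-skip t) (mMin≤top π (skip-inside t<) (top⁺ t top))

    -- Away from the front, the new maximum is itself an ascent top, so m is unchanged.
    m-insert : 1 ≤ p → m π ≡ m σ
    m-insert 1≤p = trans (m≡mMin π) (trans (≤-antisym shrinks mMin-grows) (sym (m≡mMin σ)))
      where
      new-top : IsTrue (IsAscentTop π p)
      new-top = anyUpTo⁺ _ p 1≤p (<⇒<ᵇ (subst₂ _<_ (sym (at-π-before 0 1≤p)) (sym at-π-new) (s≤s (bnd 0))))
      shrinks : mMin π ≤ mMin σ
      shrinks with mMin-attained σ
      ... | inj₁ eq = subst (mMin π ≤_) (trans at-π-new (sym eq))
                        (mMin≤top π (subst (p <_) (sym length-π) (s≤s p≤)) new-top)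
      ... | inj₂ (t , t< , top , eq) = subst (mMin π ≤_) (sym eq) (mMin≤old-top t t< top)

  -- The effect on m of prepending the new maximum: only a decreasing σ (m σ = L + 1) changes.
  bumpTop : ℕ → ℕ → ℕ
  bumpTop L v = if v ≡ᵇ suc L then suc (suc L) else v

  m-prepend : ∀ σ → Bounded (length σ) σ → m (suc (length σ) ∷ σ) ≡ bumpTop (length σ) (m σ)
  m-prepend σ bnd with m σ ≡ᵇ suc (length σ) in eq
  ... | true = trans (m≡mMin π) (≤-antisym (mMin≤default π) no-top)
    where
    open InsertMaximum (length σ) 0 σ z≤n bnd
    open InsertTop 0 σ z≤n bnd
    no-top : suc (length π) ≤ mMin π
    no-top with mMin-attained π
    ... | inj₁ eq′ = ≤-reflexive (sym eq′)
    ... | inj₂ (zero  , _  , () , _)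
    ... | inj₂ (suc t , t< , top , _) = ⊥-elim (1+n≰n (≤-trans
            (subst (_≤ at σ t) (trans (sym (m≡mMin σ)) (≡ᵇ⇒≡ _ _ (Equivalence.from T-≡ eq)))
              (mMin≤top σ (≤-pred t<) (top⁻ t top)))
            (bnd t)))
  ... | false with mMin-attained σ
  ...   | inj₁ eq′ = ⊥-elim (subst IsTrue eq (≡⇒≡ᵇ _ _ (trans (m≡mMin σ) eq′)))
    where open InsertMaximum (length σ) 0 σ z≤n bnd
  ...   | inj₂ (t , t< , top , eq′) =
    trans (m≡mMin π) (trans (≤-antisym (subst (mMin π ≤_) (sym eq′) (mMin≤old-top t t< top)) mMin-grows)
          (sym (m≡mMin σ)))
    where
    open InsertMaximum (length σ) 0 σ z≤n bnd
    open InsertTop 0 σ z≤n bnd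

  b2n : Bool → ℕ
  b2n true  = 1
  b2n false = 0

  sumOver : (List ℕ → ℕ) → List (List ℕ) → ℕ
  sumOver f []      = 0
  sumOver f (π ∷ L) = f π + sumOver f L

  count : (List ℕ → Bool) → List (List ℕ) → ℕ
  count Q = sumOver (λ π → b2n (Q π))

  count-filter : ∀ Q L → length (filter (λ π → T? (Q π)) L) ≡ count Q L
  count-filter Q []      = refl
  count-filter Q (π ∷ L) with Q π
  ... | true  = cong suc (count-filter Q L)
  ... | false = count-filter Q L

  sumOver-cong : ∀ {f g} L → (∀ {π} → π ∈ L → f π ≡ g π) → sumOver f L ≡ sumOver g L
  sumOver-cong []      eq = refl
  sumOver-cong (π ∷ L) eq = cong₂ _+_ (eq (here refl)) (sumOver-cong L (eq ∘ there))

  sumOver-+ : ∀ f g L → sumOver (λ π → f π + g π) L ≡ sumOver f L + sumOver g L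
  sumOver-+ f g []      = refl
  sumOver-+ f g (π ∷ L) = trans (cong (λ r → f π + g π + r) (sumOver-+ f g L)) (interchange (f π) (g π) _ _)
    where
    interchange : ∀ a b c d → a + b + (c + d) ≡ a + c + (b + d)
    interchange = solve-∀

  sumOver-concatMap : ∀ f (ch : List ℕ → List (List ℕ)) L →
                      sumOver f (concatMap ch L) ≡ sumOver (λ σ → sumOver f (ch σ)) L
  sumOver-concatMap f ch []      = refl
  sumOver-concatMap f ch (σ ∷ L) =
    trans (sumOver-++ (ch σ) (concatMap ch L)) (cong (λ r → sumOver f (ch σ) + r) (sumOver-concatMap f ch L))
    where
    sumOver-++ : ∀ L₁ L₂ → sumOver f (L₁ ++ L₂) ≡ sumOver f L₁ + sumOver f L₂
    sumOver-++ []       L₂ = refl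
    sumOver-++ (π ∷ L₁) L₂ = trans (cong (λ r → f π + r) (sumOver-++ L₁ L₂)) (sym (+-assoc (f π) _ _))

  count-none : ∀ Q L → (∀ {π} → π ∈ L → Q π ≡ false) → count Q L ≡ 0
  count-none Q []      none = refl
  count-none Q (π ∷ L) none rewrite none (here refl) = count-none Q L (none ∘ there)

  count-guard : ∀ c Q L → count (λ π → c ∧ Q π) L ≡ (if c then count Q L else 0)
  count-guard true  Q L = refl
  count-guard false Q L = count-none _ L (λ _ → refl)

  -- The generating tree: children of a permutation in 𝒞

  -- π ∈ 𝒞 with m(π) = a and last entry b: what the coefficient of tⁿuᵃvᵇ in H counts.
  counted : ℕ → ℕ → List ℕ → Bool
  counted a b π = inC π ∧ (m π ≡ᵇ a) ∧ (lastEntry π ≡ᵇ b)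

  ascentFirst : List ℕ → Bool
  ascentFirst π = at π 0 <ᵇ at π 1

  countedAsc : ℕ → ℕ → List ℕ → Bool
  countedAsc a b π = ascentFirst π ∧ counted a b π

  countedBumped : ℕ → ℕ → List ℕ → Bool
  countedBumped a b π = inC π ∧ (bumpTop (length π) (m π) ≡ᵇ a) ∧ (lastEntry π ≡ᵇ b)

  H-count : ∀ n a b → H (suc n) a b ≡ + count (counted a b) (perms (suc n))
  H-count n a b = cong +_ (count-filter (counted a b) (perms (suc n)))

  child : List ℕ → ℕ → List ℕ
  child σ p = insertAt p (suc (length σ)) σ

  -- Of the children of σ (length ≥ 3), only the first three can lie in 𝒞.
  count-children : ∀ σ → 3 ≤ length σ → Bounded (length σ) σ → Distinct σ →
    ∀ Q → (∀ ρ → inC ρ ≡ false → Q ρ ≡ false) →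
    count Q (insertions (suc (length σ)) σ) ≡ count Q (child σ 0 ∷ child σ 1 ∷ child σ 2 ∷ [])
  count-children σ@(s₁ ∷ s₂ ∷ s₃ ∷ τ) (s≤s (s≤s (s≤s _))) bnd dst Q Q⇒C =
    cong (λ r → b2n (Q (child σ 0)) + (b2n (Q (child σ 1)) + (b2n (Q (child σ 2)) + r)))
         (count-none Q _ late)
    where
    late : ∀ {ρ} → ρ ∈ map (s₁ ∷_) (map (s₂ ∷_) (map (s₃ ∷_) (insertions (suc (length σ)) τ))) →
           Q ρ ≡ false
    late ρ∈ with ∈-map⁻ (s₁ ∷_) ρ∈
    ... | _ , ρ∈₁ , refl with ∈-map⁻ (s₂ ∷_) ρ∈₁
    ...   | _ , ρ∈₂ , refl with ∈-map⁻ (s₃ ∷_) ρ∈₂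
    ...     | _ , ρ∈₃ , refl with ∈-insertions⁻ _ τ ρ∈₃
    ...       | q , q≤ , refl = Q⇒C _ (InsertMaximum.inC-late (length σ) (3 + q) σ
                                          (s≤s (s≤s (s≤s q≤))) bnd (s≤s (s≤s (s≤s z≤n))) dst)

  counted-cong : ∀ a b π ρ v → inC π ≡ inC ρ → m π ≡ v → lastEntry π ≡ lastEntry ρ →
                 counted a b π ≡ (inC ρ ∧ (v ≡ᵇ a) ∧ (lastEntry ρ ≡ᵇ b))
  counted-cong a b π ρ v inC-eq m-eq last-eq =
    cong₂ (λ c l → c ∧ l) inC-eq (cong₂ (λ x y → (x ≡ᵇ a) ∧ (y ≡ᵇ b)) m-eq last-eq)

  module Children (σ : List ℕ) (3≤L : 3 ≤ length σ) (bnd : Bounded (length σ) σ) (dst : Distinct σ) where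

    L : ℕ
    L = length σ

    module Child (p : ℕ) (p≤2 : p ≤ 2) where
      open InsertMaximum L p σ (≤-trans p≤2 (≤-trans (n≤1+n 2) 3≤L)) bnd public
      open InsertTop p σ (≤-trans p≤2 (≤-trans (n≤1+n 2) 3≤L)) bnd public

      lastEntry-child : lastEntry π ≡ lastEntry σ
      lastEntry-child = lastEntry-insert (≤-<-trans p≤2 3≤L)

    open Child

    no-increase : ∀ {p} → p ≤ 1 → IncreasingBefore p σ
    no-increase (s≤s z≤n) {i} {zero} ()
    no-increase z≤n {i} {j} i<j ()
    no-increase (s≤s z≤n) {i} {suc j} _ (s≤s ())

    increasing-if-ascent : ascentFirst σ ≡ true → IncreasingBefore 2 σ
    increasing-if-ascent asc {zero}  {suc zero}    _        _             = <ᵇ⇒< _ _ (Equivalence.from T-≡ asc)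
    increasing-if-ascent asc {suc i} {suc zero}    (s≤s ()) _
    increasing-if-ascent asc {_}     {suc (suc _)} _        (s≤s (s≤s ()))

    descent-if-no-ascent : ascentFirst σ ≡ false → at σ 1 < at σ 0
    descent-if-no-ascent asc =
      ≤∧≢⇒< (≮⇒≥ (λ lt → subst IsTrue asc (<⇒<ᵇ lt)))
             (λ eq → 1≢0 (dst (≤-trans (s≤s z<s) 3≤L) (≤-trans z<s 3≤L) eq))
      where
      1≢0 : 1 ≢ 0
      1≢0 ()

    counted-child₀ : ∀ a b → counted a b (child σ 0) ≡ countedBumped a b σ
    counted-child₀ a b = counted-cong a b (child σ 0) σ _
      (inC-insert 0 z≤n z≤n (no-increase z≤n)) (m-prepend σ bnd) (lastEntry-child 0 z≤n)

    counted-child₁ : ∀ a b → counted a b (child σ 1) ≡ counted a b σ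
    counted-child₁ a b = counted-cong a b (child σ 1) σ _
      (inC-insert 1 (s≤s z≤n) (s≤s z≤n) (no-increase (s≤s z≤n)))
      (m-insert 1 (s≤s z≤n) (s≤s z≤n)) (lastEntry-child 1 (s≤s z≤n))

    counted-child₂ : ∀ a b → counted a b (child σ 2) ≡ countedAsc a b σ
    counted-child₂ a b = by-first-ascent (ascentFirst σ) refl
      where
      by-first-ascent : ∀ x → ascentFirst σ ≡ x → counted a b (child σ 2) ≡ countedAsc a b σ
      by-first-ascent true  asc =
        trans (counted-cong a b (child σ 2) σ _ (inC-insert 2 ≤-refl ≤-refl (increasing-if-ascent asc))
                                              (m-insert 2 ≤-refl (s≤s z≤n)) (lastEntry-child 2 ≤-refl))
              (cong (λ x → x ∧ counted a b σ) (sym asc))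
      by-first-ascent false asc =
        trans (cong (λ c → c ∧ (m (child σ 2) ≡ᵇ a) ∧ (lastEntry (child σ 2) ≡ᵇ b))
                    (inC-after-descent 2 ≤-refl ≤-refl (descent-if-no-ascent asc)))
              (cong (λ x → x ∧ counted a b σ) (sym asc))

    ascentFirst-child₀ : ascentFirst (child σ 0) ≡ false
    ascentFirst-child₀ = <ᵇ-false (m≤n⇒m≤1+n (bnd 0))

    ascentFirst-child₁ : ascentFirst (child σ 1) ≡ true
    ascentFirst-child₁ = Equivalence.to T-≡ (<⇒<ᵇ (subst₂ _<_ (sym (at-π-before 1 (s≤s z≤n) 0 z<s))
                                                            (sym (at-π-new 1 (s≤s z≤n))) (s≤s (bnd 0))))

    ascentFirst-child₂ : ascentFirst (child σ 2) ≡ ascentFirst σ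
    ascentFirst-child₂ = cong₂ _<ᵇ_ (at-π-before 2 ≤-refl 0 z<s) (at-π-before 2 ≤-refl 1 (s≤s z<s))

    countedAsc-child₀ : ∀ a b → countedAsc a b (child σ 0) ≡ false
    countedAsc-child₀ a b = cong (λ x → x ∧ counted a b (child σ 0)) ascentFirst-child₀

    countedAsc-child₁ : ∀ a b → countedAsc a b (child σ 1) ≡ counted a b σ
    countedAsc-child₁ a b = cong₂ _∧_ ascentFirst-child₁ (counted-child₁ a b)

    countedAsc-child₂ : ∀ a b → countedAsc a b (child σ 2) ≡ countedAsc a b σ
    countedAsc-child₂ a b = begin
      ascentFirst (child σ 2) ∧ counted a b (child σ 2)
        ≡⟨ cong₂ _∧_ ascentFirst-child₂ (counted-child₂ a b) ⟩
      ascentFirst σ ∧ (ascentFirst σ ∧ counted a b σ)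
        ≡⟨ sym (∧-assoc (ascentFirst σ) (ascentFirst σ) _) ⟩
      (ascentFirst σ ∧ ascentFirst σ) ∧ counted a b σ
        ≡⟨ cong (λ x → x ∧ counted a b σ) (∧-idem (ascentFirst σ)) ⟩
      ascentFirst σ ∧ counted a b σ ∎
      where open ≡-Reasoning

  counted-∉C : ∀ a b ρ → inC ρ ≡ false → counted a b ρ ≡ false
  counted-∉C a b ρ ρ∉ = cong (λ c → c ∧ (m ρ ≡ᵇ a) ∧ (lastEntry ρ ≡ᵇ b)) ρ∉

  countedAsc-∉C : ∀ a b ρ → inC ρ ≡ false → countedAsc a b ρ ≡ false
  countedAsc-∉C a b ρ ρ∉ = trans (cong (ascentFirst ρ ∧_) (counted-∉C a b ρ ρ∉)) (∧-zeroʳ _)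

  count-three : ∀ Q x y z → count Q (x ∷ y ∷ z ∷ []) ≡ b2n (Q x) + (b2n (Q y) + b2n (Q z))
  count-three Q x y z = cong (λ r → b2n (Q x) + (b2n (Q y) + r)) (+-identityʳ _)

  children-counted : ∀ n σ → IsPerm n σ → 3 ≤ n → ∀ a b →
    count (counted a b) (insertions (suc n) σ) ≡
    b2n (countedBumped a b σ) + (b2n (counted a b σ) + b2n (countedAsc a b σ))
  children-counted _ σ (refl , bnd , dst) 3≤n a b = begin
    count (counted a b) (insertions (suc (length σ)) σ)
      ≡⟨ count-children σ 3≤n bnd dst (counted a b) (counted-∉C a b) ⟩
    count (counted a b) (child σ 0 ∷ child σ 1 ∷ child σ 2 ∷ [])
      ≡⟨ count-three (counted a b) (child σ 0) (child σ 1) (child σ 2) ⟩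
    b2n (counted a b (child σ 0)) + (b2n (counted a b (child σ 1)) + b2n (counted a b (child σ 2)))
      ≡⟨ cong₂ (λ x y → b2n x + y) (counted-child₀ a b)
               (cong₂ (λ y z → b2n y + b2n z) (counted-child₁ a b) (counted-child₂ a b)) ⟩
    b2n (countedBumped a b σ) + (b2n (counted a b σ) + b2n (countedAsc a b σ)) ∎
    where
    open ≡-Reasoning
    open Children σ 3≤n bnd dst

  children-countedAsc : ∀ n σ → IsPerm n σ → 3 ≤ n → ∀ a b →
    count (countedAsc a b) (insertions (suc n) σ) ≡ b2n (counted a b σ) + b2n (countedAsc a b σ)
  children-countedAsc _ σ (refl , bnd , dst) 3≤n a b = begin
    count (countedAsc a b) (insertions (suc (length σ)) σ)
      ≡⟨ count-children σ 3≤n bnd dst (countedAsc a b) (countedAsc-∉C a b) ⟩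
    count (countedAsc a b) (child σ 0 ∷ child σ 1 ∷ child σ 2 ∷ [])
      ≡⟨ count-three (countedAsc a b) (child σ 0) (child σ 1) (child σ 2) ⟩
    b2n (countedAsc a b (child σ 0)) + (b2n (countedAsc a b (child σ 1)) + b2n (countedAsc a b (child σ 2)))
      ≡⟨ cong₂ (λ x y → b2n x + y) (countedAsc-child₀ a b)
               (cong₂ (λ y z → b2n y + b2n z) (countedAsc-child₁ a b) (countedAsc-child₂ a b)) ⟩
    b2n (counted a b σ) + b2n (countedAsc a b σ) ∎
    where
    open ≡-Reasoning
    open Children σ 3≤n bnd dst

  -- Recurrences for the coefficients

  h hAsc hBump : ℕ → ℕ → ℕ → ℕ
  h     n a b = count (counted a b) (perms n)
  hAsc  n a b = count (countedAsc a b) (perms n)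
  hBump n a b = count (countedBumped a b) (perms n)

  recurrence-h : ∀ n → 3 ≤ n → ∀ a b → h (suc n) a b ≡ hBump n a b + (h n a b + hAsc n a b)
  recurrence-h n 3≤n a b = begin
    h (suc n) a b
      ≡⟨ sumOver-concatMap _ (insertions (suc n)) (perms n) ⟩
    sumOver (λ σ → count (counted a b) (insertions (suc n) σ)) (perms n)
      ≡⟨ sumOver-cong (perms n) (λ {σ} σ∈ → children-counted n σ (perms-IsPerm n σ∈) 3≤n a b) ⟩
    sumOver (λ σ → b2n (countedBumped a b σ) + (b2n (counted a b σ) + b2n (countedAsc a b σ))) (perms n)
      ≡⟨ sumOver-+ _ _ (perms n) ⟩
    hBump n a b + sumOver (λ σ → b2n (counted a b σ) + b2n (countedAsc a b σ)) (perms n)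
      ≡⟨ cong (λ r → hBump n a b + r) (sumOver-+ _ _ (perms n)) ⟩
    hBump n a b + (h n a b + hAsc n a b) ∎
    where open ≡-Reasoning

  recurrence-hAsc : ∀ n → 3 ≤ n → ∀ a b → hAsc (suc n) a b ≡ h n a b + hAsc n a b
  recurrence-hAsc n 3≤n a b = begin
    hAsc (suc n) a b
      ≡⟨ sumOver-concatMap _ (insertions (suc n)) (perms n) ⟩
    sumOver (λ σ → count (countedAsc a b) (insertions (suc n) σ)) (perms n)
      ≡⟨ sumOver-cong (perms n) (λ {σ} σ∈ → children-countedAsc n σ (perms-IsPerm n σ∈) 3≤n a b) ⟩
    sumOver (λ σ → b2n (counted a b σ) + b2n (countedAsc a b σ)) (perms n)
      ≡⟨ sumOver-+ _ _ (perms n) ⟩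
    h n a b + hAsc n a b ∎
    where open ≡-Reasoning

  bump-indicator : ∀ (c l : Bool) N v a →
    b2n (c ∧ (bumpTop N v ≡ᵇ a) ∧ l) + b2n ((suc N ≡ᵇ a) ∧ c ∧ (v ≡ᵇ suc N) ∧ l) ≡
    b2n (c ∧ (v ≡ᵇ a) ∧ l) + b2n ((suc (suc N) ≡ᵇ a) ∧ c ∧ (v ≡ᵇ suc N) ∧ l)
  bump-indicator false l N v a rewrite ∧-zeroʳ (suc N ≡ᵇ a) | ∧-zeroʳ (suc (suc N) ≡ᵇ a) = refl
  bump-indicator true false N v a
    rewrite ∧-zeroʳ (bumpTop N v ≡ᵇ a) | ∧-zeroʳ (v ≡ᵇ a) | ∧-zeroʳ (v ≡ᵇ suc N)
          | ∧-zeroʳ (suc N ≡ᵇ a) | ∧-zeroʳ (suc (suc N) ≡ᵇ a) = refl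
  bump-indicator true true N v a with v ≡ᵇ suc N in top
  ... | false rewrite ∧-zeroʳ (suc N ≡ᵇ a) | ∧-zeroʳ (suc (suc N) ≡ᵇ a) = refl
  ... | true rewrite ≡ᵇ⇒≡ v (suc N) (Equivalence.from T-≡ top)
                   | ∧-identityʳ (suc (suc N) ≡ᵇ a) | ∧-identityʳ (suc N ≡ᵇ a) =
    +-comm (b2n (suc (suc N) ≡ᵇ a)) (b2n (suc N ≡ᵇ a))

  corr : ℕ → ℕ → ℕ → ℕ → ℕ
  corr n a b j = if j + n ≡ᵇ a then h n (suc n) b else 0

  -- Summing bump-indicator over σ ∈ 𝔖ₙ: hBump differs from h only at a = n+1, n+2.
  bump-relation : ∀ n a b → hBump n a b + corr n a b 1 ≡ h n a b + corr n a b 2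
  bump-relation n a b = begin
    hBump n a b + corr n a b 1
      ≡⟨ cong (λ r → hBump n a b + r) (sym (count-guard (1 + n ≡ᵇ a) (counted (suc n) b) (perms n))) ⟩
    hBump n a b + count (λ σ → (1 + n ≡ᵇ a) ∧ counted (suc n) b σ) (perms n)
      ≡⟨ sym (sumOver-+ _ _ (perms n)) ⟩
    sumOver (λ σ → b2n (countedBumped a b σ) + b2n ((1 + n ≡ᵇ a) ∧ counted (suc n) b σ)) (perms n)
      ≡⟨ sumOver-cong (perms n) (λ {σ} σ∈ → per-σ σ (proj₁ (perms-IsPerm n σ∈))) ⟩
    sumOver (λ σ → b2n (counted a b σ) + b2n ((2 + n ≡ᵇ a) ∧ counted (suc n) b σ)) (perms n)
      ≡⟨ sumOver-+ _ _ (perms n) ⟩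
    h n a b + count (λ σ → (2 + n ≡ᵇ a) ∧ counted (suc n) b σ) (perms n)
      ≡⟨ cong (λ r → h n a b + r) (count-guard (2 + n ≡ᵇ a) (counted (suc n) b) (perms n)) ⟩
    h n a b + corr n a b 2 ∎
    where
    open ≡-Reasoning
    per-σ : ∀ σ → length σ ≡ n →
      b2n (countedBumped a b σ) + b2n ((1 + n ≡ᵇ a) ∧ counted (suc n) b σ) ≡
      b2n (counted a b σ) + b2n ((2 + n ≡ᵇ a) ∧ counted (suc n) b σ)
    per-σ σ refl = bump-indicator (inC σ) (lastEntry σ ≡ᵇ b) (length σ) (m σ) a

  counted-outside : ∀ n a b → suc n < a ⊎ n < b → ∀ {π} → π ∈ perms n → counted a b π ≡ false
  counted-outside n a b out {π} π∈ with perms-IsPerm n π∈ | out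
  ... | refl , bnd , _ | inj₁ big-a =
    trans (cong (λ x → inC π ∧ x ∧ (lastEntry π ≡ᵇ b))
                (≡ᵇ-false (m π) a (λ eq → <⇒≱ big-a (subst (_≤ suc (length π)) eq (m≤ π)))))
          (∧-zeroʳ (inC π))
  ... | refl , bnd , _ | inj₂ big-b =
    trans (cong (λ x → inC π ∧ (m π ≡ᵇ a) ∧ x)
                (≡ᵇ-false (lastEntry π) b (λ eq → <⇒≱ big-b (subst (_≤ length π) eq (bnd _)))))
          (trans (cong (inC π ∧_) (∧-zeroʳ (m π ≡ᵇ a))) (∧-zeroʳ (inC π)))

  h-outside : ∀ n a b → suc n < a ⊎ n < b → h n a b ≡ 0
  h-outside n a b out = count-none _ (perms n) (counted-outside n a b out)

  hAsc-outside : ∀ n a b → suc n < a ⊎ n < b → hAsc n a b ≡ 0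
  hAsc-outside n a b out = count-none _ (perms n)
    (λ {π} π∈ → trans (cong (ascentFirst π ∧_) (counted-outside n a b out π∈)) (∧-zeroʳ _))

  -- The permutations with the largest possible m (the decreasing ones) persist: only the
  -- child obtained by prepending n+1 keeps m maximal.
  h-top-shift : ∀ n → 3 ≤ n → ∀ b → h (suc n) (2 + n) b ≡ h n (1 + n) b
  h-top-shift n 3≤n b = begin
    h (suc n) (2 + n) b
      ≡⟨ recurrence-h n 3≤n (2 + n) b ⟩
    hBump n (2 + n) b + (h n (2 + n) b + hAsc n (2 + n) b)
      ≡⟨ cong₂ (λ x y → hBump n (2 + n) b + (x + y)) (h-outside n _ b above) (hAsc-outside n _ b above) ⟩
    hBump n (2 + n) b + 0
      ≡⟨ cong (λ t → hBump n (2 + n) b + (if t then h n (suc n) b else 0))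
              (sym (≡ᵇ-false (suc n) (2 + n) (<⇒≢ (n<1+n (suc n))))) ⟩
    hBump n (2 + n) b + corr n (2 + n) b 1
      ≡⟨ bump-relation n (2 + n) b ⟩
    h n (2 + n) b + corr n (2 + n) b 2
      ≡⟨ cong₂ (λ x t → x + (if t then h n (suc n) b else 0)) (h-outside n _ b above) (≡ᵇ-refl (2 + n)) ⟩
    h n (1 + n) b ∎
    where
    open ≡-Reasoning
    above : suc n < 2 + n ⊎ n < b
    above = inj₁ ≤-refl

  corr-suc : ∀ n → 3 ≤ n → ∀ a b j → corr (suc n) a b j ≡ corr n a b (suc j)
  corr-suc n 3≤n a b j =
    cong₂ (λ x X → if x ≡ᵇ a then X else 0) (+-suc j n) (h-top-shift n 3≤n b)

  -- The recurrences combine into h(n+2) − 3h(n+1) + h(n) = c₁ − 2c₂ + c₃ (cⱼ = corr n a b j).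
  second-difference : ∀ n → 3 ≤ n → ∀ a b →
    h (2 + n) a b + h n a b + (corr n a b 2 + corr n a b 2) ≡
    h (1 + n) a b + h (1 + n) a b + h (1 + n) a b + corr n a b 1 + corr n a b 3
  second-difference n 3≤n a b = begin
    h₂ + h₀ + (c₂ + c₂)
      ≡⟨ cong (λ x → x + h₀ + (c₂ + c₂))
              (trans (recurrence-h (suc n) 3≤1+n a b)
                     (cong (λ y → g₁ + (h₁ + y)) (recurrence-hAsc n 3≤n a b))) ⟩
    g₁ + (h₁ + (h₀ + k₀)) + h₀ + (c₂ + c₂)
      ≡⟨ regroup₁ g₁ h₁ h₀ k₀ c₂ ⟩
    (g₁ + c₂) + (h₁ + h₀ + k₀ + (h₀ + c₂))
      ≡⟨ cong₂ (λ x y → x + (h₁ + h₀ + k₀ + y)) E₅ (sym (bump-relation n a b)) ⟩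
    (h₁ + c₃) + (h₁ + h₀ + k₀ + (g₀ + c₁))
      ≡⟨ regroup₂ h₁ c₃ h₀ k₀ g₀ c₁ ⟩
    h₁ + h₁ + (g₀ + (h₀ + k₀)) + c₁ + c₃
      ≡⟨ cong (λ x → h₁ + h₁ + x + c₁ + c₃) (sym (recurrence-h n 3≤n a b)) ⟩
    h₁ + h₁ + h₁ + c₁ + c₃ ∎
    where
    open ≡-Reasoning
    3≤1+n = ≤-trans 3≤n (n≤1+n n)
    h₀ = h n a b
    h₁ = h (1 + n) a b
    h₂ = h (2 + n) a b
    k₀ = hAsc n a b
    g₀ = hBump n a b
    g₁ = hBump (1 + n) a b
    c₁ = corr n a b 1
    c₂ = corr n a b 2
    c₃ = corr n a b 3
    E₅ : g₁ + c₂ ≡ h₁ + c₃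
    E₅ = subst₂ (λ x y → g₁ + x ≡ h₁ + y) (corr-suc n 3≤n a b 1) (corr-suc n 3≤n a b 2)
                (bump-relation (suc n) a b)
    regroup₁ : ∀ g₁ h₁ h₀ k₀ c₂ →
      g₁ + (h₁ + (h₀ + k₀)) + h₀ + (c₂ + c₂) ≡ (g₁ + c₂) + (h₁ + h₀ + k₀ + (h₀ + c₂))
    regroup₁ = solve-∀
    regroup₂ : ∀ h₁ c₃ h₀ k₀ g₀ c₁ →
      (h₁ + c₃) + (h₁ + h₀ + k₀ + (g₀ + c₁)) ≡ h₁ + h₁ + (g₀ + (h₀ + k₀)) + c₁ + c₃
    regroup₂ = solve-∀

module PowerSeries where

  open import Data.Bool using (Bool; true; false; if_then_else_) renaming (T to IsTrue)
  open import Data.Bool.Properties using (T-≡)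
  open import Data.Integer using (ℤ; +_; _+_; _*_; -_; _-_)
  open import Data.Integer.Properties
    using (+-identityʳ; +-identityˡ; +-assoc; *-zeroʳ; *-distribˡ-+; *-distribʳ-+; neg-distrib-+)
  open import Data.List using (List; []; _∷_; map; _++_; applyUpTo; foldr)
  open import Data.Nat as ℕ using (ℕ; zero; suc; _∸_; _≤_; _<_; _≤ᵇ_; _≡ᵇ_; z≤n; s≤s)
  open import Data.Nat.Properties as ℕₚ
    using (≡ᵇ⇒≡; ≡⇒≡ᵇ; ≤ᵇ⇒≤; ≤⇒≤ᵇ; ≰⇒>; <⇒≱; <⇒≢; ≤-trans; <-≤-trans; m∸n≤m; m∸[m∸n]≡n; m∸n+n≡m;
           m+n∸n≡m; m≤n+m; suc-injective; ∸-monoˡ-≤; +-∸-comm; _≤?_)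
  open import Data.List.Relation.Unary.All using (All; []; _∷_)
  open import Data.Sum as Sum using (_⊎_; inj₁; inj₂)
  open import Relation.Nullary using (yes; no)
  open import Data.Integer.Tactic.RingSolver using (solve-∀)
  open import Data.Product using (Σ; _×_; _,_)
  open import Function.Base using (_∘_)
  open import Function.Bundles using (Equivalence)
  open import Relation.Binary.PropositionalEquality hiding ([_])

  open BooleanTests

  sumTo : ℕ → (ℕ → ℤ) → ℤ
  sumTo zero    f = + 0
  sumTo (suc m) f = f 0 + sumTo m (λ i → f (suc i))

  Σ≤-sumTo : ∀ n f → Σ≤ n f ≡ sumTo (suc n) f
  Σ≤-sumTo n f = fold (λ i → i) (suc n)
    where
    fold : ∀ g m → foldr (λ i acc → f i + acc) (+ 0) (applyUpTo g m) ≡ sumTo m (λ i → f (g i))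
    fold g zero    = refl
    fold g (suc m) = cong (λ s → f (g 0) + s) (fold (λ i → g (suc i)) m)

  sumTo-cong : ∀ m {f g} → (∀ i → i < m → f i ≡ g i) → sumTo m f ≡ sumTo m g
  sumTo-cong zero    eq = refl
  sumTo-cong (suc m) eq = cong₂ _+_ (eq 0 (s≤s z≤n)) (sumTo-cong m (λ i i<m → eq (suc i) (s≤s i<m)))

  sumTo-zero : ∀ m {f} → (∀ i → i < m → f i ≡ + 0) → sumTo m f ≡ + 0
  sumTo-zero m zero-f = trans (sumTo-cong m zero-f) (all-zero m)
    where
    all-zero : ∀ m → sumTo m (λ _ → + 0) ≡ + 0
    all-zero zero    = refl
    all-zero (suc m) = trans (+-identityˡ _) (all-zero m)

  sumTo-+ : ∀ m f g → sumTo m (λ i → f i + g i) ≡ sumTo m f + sumTo m g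
  sumTo-+ zero    f g = refl
  sumTo-+ (suc m) f g = trans (cong (λ s → f 0 + g 0 + s) (sumTo-+ m (λ i → f (suc i)) (λ i → g (suc i))))
                              (interchange (f 0) (g 0) _ _)
    where
    interchange : ∀ a b c d → a + b + (c + d) ≡ a + c + (b + d)
    interchange = solve-∀

  sumTo-single : ∀ m c {f} → c < m → (∀ i → i < m → i ≢ c → f i ≡ + 0) → sumTo m f ≡ f c
  sumTo-single (suc m) zero {f} c<m others =
    trans (cong (λ s → f 0 + s) (sumTo-zero m (λ i i<m → others (suc i) (s≤s i<m) λ ()))) (+-identityʳ _)
  sumTo-single (suc m) (suc c) {f} (s≤s c<m) others =
    trans (cong (λ x → x + sumTo m (λ i → f (suc i))) (others 0 (s≤s z≤n) λ ()))
          (trans (+-identityˡ _)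
                 (sumTo-single m c c<m (λ i i<m i≢c → others (suc i) (s≤s i<m) (i≢c ∘ suc-injective))))

  Σ≤-cong : ∀ N {f g} → (∀ i → i ≤ N → f i ≡ g i) → Σ≤ N f ≡ Σ≤ N g
  Σ≤-cong N {f} {g} eq = trans (Σ≤-sumTo N f)
    (trans (sumTo-cong (suc N) (λ i i≤N → eq i (ℕₚ.≤-pred i≤N))) (sym (Σ≤-sumTo N g)))

  Σ≤-zero : ∀ N {f} → (∀ i → i ≤ N → f i ≡ + 0) → Σ≤ N f ≡ + 0
  Σ≤-zero N {f} zero-f = trans (Σ≤-sumTo N f) (sumTo-zero (suc N) (λ i i≤N → zero-f i (ℕₚ.≤-pred i≤N)))

  Σ≤-+ : ∀ N f g → Σ≤ N (λ i → f i + g i) ≡ Σ≤ N f + Σ≤ N g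
  Σ≤-+ N f g = trans (Σ≤-sumTo N (λ i → f i + g i))
    (trans (sumTo-+ (suc N) f g) (sym (cong₂ _+_ (Σ≤-sumTo N f) (Σ≤-sumTo N g))))

  Σ≤-single : ∀ N P G R → (∀ i → i ≤ N → (N ∸ i ≡ᵇ P) ≡ false → G i ≡ + 0) → (P ≤ N → G (N ∸ P) ≡ R) →
              Σ≤ N G ≡ (if P ≤ᵇ N then R else + 0)
  Σ≤-single N P G R off on with P ≤ᵇ N in P≤ᵇN
  ... | true  = trans (Σ≤-sumTo N G) (trans (sumTo-single (suc N) (N ∸ P) (s≤s (m∸n≤m N P)) others) (on P≤N))
    where
    P≤N : P ≤ N
    P≤N = ≤ᵇ⇒≤ P N (Equivalence.from T-≡ P≤ᵇN)
    others : ∀ i → i < suc N → i ≢ N ∸ P → G i ≡ + 0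
    others i (s≤s i≤N) i≢ =
      off i i≤N (≡ᵇ-false (N ∸ i) P (λ eq → i≢ (trans (sym (m∸[m∸n]≡n i≤N)) (cong (N ∸_) eq))))
  ... | false = trans (Σ≤-sumTo N G) (sumTo-zero (suc N) λ i i≤N → off i (ℕₚ.≤-pred i≤N)
                  (≡ᵇ-false (N ∸ i) P (λ eq → <⇒≱ N<P (subst (_≤ N) eq (m∸n≤m N i)))))
    where
    N<P : N < P
    N<P = ≰⇒> (λ P≤N → subst IsTrue P≤ᵇN (≤⇒≤ᵇ P≤N))

  𝟘 : FPS
  𝟘 _ _ _ = + 0

  ≈-trans : ∀ {f g h} → f ≈ g → g ≈ h → f ≈ h
  ≈-trans f≈g g≈h n a b = trans (f≈g n a b) (g≈h n a b)

  ⊛-cong : ∀ {f f′ g g′} → f ≈ f′ → g ≈ g′ → (f ⊛ g) ≈ (f′ ⊛ g′)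
  ⊛-cong f≈ g≈ n a b = Σ≤-cong n λ i _ → Σ≤-cong a λ j _ → Σ≤-cong b λ k _ →
    cong₂ _*_ (f≈ i j k) (g≈ (n ∸ i) (a ∸ j) (b ∸ k))

  ⊛-distribˡ-⊕ : ∀ f g h → (f ⊛ (g ⊕ h)) ≈ ((f ⊛ g) ⊕ (f ⊛ h))
  ⊛-distribˡ-⊕ f g h n a b =
    trans (Σ≤-cong n {g = λ i → Σ≤ a (λ j → Σ≤ b (P i j)) + Σ≤ a (λ j → Σ≤ b (Q i j))} λ i _ →
           trans (Σ≤-cong a {g = λ j → Σ≤ b (P i j) + Σ≤ b (Q i j)} λ j _ →
                  trans (Σ≤-cong b {g = λ k → P i j k + Q i j k} λ k _ → *-distribˡ-+ (f i j k) _ _)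
                        (Σ≤-+ b (P i j) (Q i j)))
                 (Σ≤-+ a (λ j → Σ≤ b (P i j)) (λ j → Σ≤ b (Q i j))))
          (Σ≤-+ n (λ i → Σ≤ a (λ j → Σ≤ b (P i j))) (λ i → Σ≤ a (λ j → Σ≤ b (Q i j))))
    where
    P Q : ℕ → ℕ → ℕ → ℤ
    P i j k = f i j k * g (n ∸ i) (a ∸ j) (b ∸ k)
    Q i j k = f i j k * h (n ∸ i) (a ∸ j) (b ∸ k)

  ⊛-zeroʳ : ∀ f → (f ⊛ 𝟘) ≈ 𝟘
  ⊛-zeroʳ f n a b = Σ≤-zero n λ i _ → Σ≤-zero a λ j _ → Σ≤-zero b λ k _ → *-zeroʳ (f i j k)

  record Monomial : Set where
    constructor mono
    field
      coeff : ℤ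
      tdeg udeg vdeg : ℕ

  ⟦_⟧ₘ : Monomial → FPS
  ⟦ mono c p q r ⟧ₘ n a b =
    if n ≡ᵇ p then (if a ≡ᵇ q then (if b ≡ᵇ r then c else + 0) else + 0) else + 0

  -- f · c tᵖ uᵠ vʳ, obtained by shifting the coefficients of f.
  shiftBy : Monomial → FPS → FPS
  shiftBy (mono c p q r) f n a b =
    if p ≤ᵇ n then (if q ≤ᵇ a then (if r ≤ᵇ b then f (n ∸ p) (a ∸ q) (b ∸ r) * c else + 0) else + 0) else + 0

  if-true : ∀ {A : Set} {t} {x y : A} → t ≡ true → (if t then x else y) ≡ x
  if-true refl = refl

  -- Multiplying by a monomial shifts the coefficients: in each of the three nested sums
  -- only the index n ∸ p (resp. a ∸ q, b ∸ r) contributes.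
  ⊛-monomial : ∀ f x → (f ⊛ ⟦ x ⟧ₘ) ≈ shiftBy x f
  ⊛-monomial f (mono c p q r) n a b =
    Σ≤-single n p (λ i → Σ≤ a λ j → Σ≤ b λ k → f i j k * [ n ∸ i ≡ᵇ p ] (uv j k)) (u-sum (n ∸ p))
      (λ i _ off → Σ≤-zero a λ j _ → Σ≤-zero b λ k _ → killed (f i j k) (uv j k) off)
      (λ p≤n → trans (Σ≤-cong a {g = λ j → Σ≤ b λ k → f (n ∸ p) j k * uv j k} λ j _ →
                      Σ≤-cong b {g = λ k → f (n ∸ p) j k * uv j k} λ k _ →
                      cong (f (n ∸ p) j k *_) (if-true {y = + 0} (undo p≤n)))
                     (u-level (n ∸ p)))
    where
    [_]_ : Bool → ℤ → ℤ
    [ t ] y = if t then y else + 0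
    uv : ℕ → ℕ → ℤ
    uv j k = [ a ∸ j ≡ᵇ q ] ([ b ∸ k ≡ᵇ r ] c)
    u-sum v-sum : ℕ → ℤ
    u-sum i = [ q ≤ᵇ a ] (v-sum i)
    v-sum i = [ r ≤ᵇ b ] (f i (a ∸ q) (b ∸ r) * c)

    killed : ∀ x y {t} → t ≡ false → x * [ t ] y ≡ + 0
    killed x y refl = *-zeroʳ x
    undo : ∀ {N P} → P ≤ N → (N ∸ (N ∸ P) ≡ᵇ P) ≡ true
    undo {N} {P} P≤N = trans (cong (_≡ᵇ P) (m∸[m∸n]≡n P≤N)) (≡ᵇ-refl P)

    u-level : ∀ i → Σ≤ a (λ j → Σ≤ b λ k → f i j k * uv j k) ≡ u-sum i
    u-level i = Σ≤-single a q (λ j → Σ≤ b λ k → f i j k * uv j k) (v-sum i)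
      (λ j _ off → Σ≤-zero b λ k _ → killed (f i j k) ([ b ∸ k ≡ᵇ r ] c) off)
      (λ q≤a → trans (Σ≤-cong b {g = λ k → f i (a ∸ q) k * [ b ∸ k ≡ᵇ r ] c} λ k _ →
                      cong (f i (a ∸ q) k *_) (if-true {y = + 0} (undo q≤a))) v-level)
      where
      v-level : Σ≤ b (λ k → f i (a ∸ q) k * [ b ∸ k ≡ᵇ r ] c) ≡ v-sum i
      v-level = Σ≤-single b r (λ k → f i (a ∸ q) k * [ b ∸ k ≡ᵇ r ] c) (f i (a ∸ q) (b ∸ r) * c)
        (λ k _ off → killed (f i (a ∸ q) k) c off)
        (λ r≤b → cong (f i (a ∸ q) (b ∸ r) *_) (if-true {y = + 0} (undo r≤b)))

  Poly : Set
  Poly = List Monomial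

  ⟦_⟧ : Poly → FPS
  ⟦ []    ⟧ = 𝟘
  ⟦ x ∷ P ⟧ = ⟦ x ⟧ₘ ⊕ ⟦ P ⟧

  shiftByPoly : Poly → FPS → FPS
  shiftByPoly []      f = 𝟘
  shiftByPoly (x ∷ Q) f = shiftBy x f ⊕ shiftByPoly Q f

  ⊛-poly : ∀ f Q → (f ⊛ ⟦ Q ⟧) ≈ shiftByPoly Q f
  ⊛-poly f []      = ⊛-zeroʳ f
  ⊛-poly f (x ∷ Q) n a b =
    trans (⊛-distribˡ-⊕ f ⟦ x ⟧ₘ ⟦ Q ⟧ n a b) (cong₂ _+_ (⊛-monomial f x n a b) (⊛-poly f Q n a b))

  _·ₘ_ : Monomial → Monomial → Monomial
  mono c p q r ·ₘ mono d i j k = mono (d * c) (i ℕ.+ p) (j ℕ.+ q) (k ℕ.+ r)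

  _·_ : Poly → Poly → Poly
  P · []      = []
  P · (x ∷ Q) = map (x ·ₘ_) P ++ (P · Q)

  negₘ : Monomial → Monomial
  negₘ (mono c p q r) = mono (- c) p q r

  shift-index : ∀ p n i → (p ≤ᵇ n) ≡ true → (n ∸ p ≡ᵇ i) ≡ (n ≡ᵇ i ℕ.+ p)
  shift-index p n i p≤ᵇn with n ∸ p ≡ᵇ i in eq
  ... | true  = sym (trans (cong (_≡ᵇ i ℕ.+ p) n≡i+p) (≡ᵇ-refl (i ℕ.+ p)))
    where
    n≡i+p : n ≡ i ℕ.+ p
    n≡i+p = trans (sym (m∸n+n≡m (≤ᵇ⇒≤ p n (Equivalence.from T-≡ p≤ᵇn))))
                  (cong (ℕ._+ p) (≡ᵇ⇒≡ _ _ (Equivalence.from T-≡ eq)))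
  ... | false = sym (≡ᵇ-false n (i ℕ.+ p) λ n≡ →
                  subst IsTrue eq (≡⇒≡ᵇ _ _ (trans (cong (_∸ p) n≡) (m+n∸n≡m i p))))

  shift-index-out : ∀ p n i → (p ≤ᵇ n) ≡ false → (n ≡ᵇ i ℕ.+ p) ≡ false
  shift-index-out p n i p≰ᵇn = ≡ᵇ-false n (i ℕ.+ p) λ n≡ →
    subst IsTrue p≰ᵇn (≤⇒≤ᵇ (subst (p ≤_) (sym n≡) (m≤n+m p i)))

  if-same : ∀ t (x : ℤ) → (if t then x else x) ≡ x
  if-same true  x = refl
  if-same false x = refl

  shiftBy-monomial : ∀ x y → shiftBy x ⟦ y ⟧ₘ ≈ ⟦ x ·ₘ y ⟧ₘ
  shiftBy-monomial (mono c p q r) (mono d i j k) n a b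
    with p ≤ᵇ n in p≤n | q ≤ᵇ a in q≤a | r ≤ᵇ b in r≤b
  ... | false | _     | _     rewrite shift-index-out p n i p≤n = refl
  ... | true  | false | _     rewrite shift-index-out q a j q≤a = sym (if-same (n ≡ᵇ i ℕ.+ p) (+ 0))
  ... | true  | true  | false rewrite shift-index-out r b k r≤b =
    sym (trans (cong (λ y → if n ≡ᵇ i ℕ.+ p then y else + 0) (if-same (a ≡ᵇ j ℕ.+ q) (+ 0)))
               (if-same (n ≡ᵇ i ℕ.+ p) (+ 0)))
  ... | true  | true  | true
    rewrite sym (shift-index p n i p≤n) | sym (shift-index q a j q≤a) | sym (shift-index r b k r≤b)
    with n ∸ p ≡ᵇ i | a ∸ q ≡ᵇ j | b ∸ r ≡ᵇ k
  ...   | false | _     | _     = refl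
  ...   | true  | false | _     = refl
  ...   | true  | true  | false = refl
  ...   | true  | true  | true  = refl

  shiftBy-cong : ∀ x {f g} → f ≈ g → shiftBy x f ≈ shiftBy x g
  shiftBy-cong (mono c p q r) f≈g n a b with p ≤ᵇ n | q ≤ᵇ a | r ≤ᵇ b
  ... | false | _     | _     = refl
  ... | true  | false | _     = refl
  ... | true  | true  | false = refl
  ... | true  | true  | true  = cong (_* c) (f≈g (n ∸ p) (a ∸ q) (b ∸ r))

  shiftBy-⊕ : ∀ x f g → shiftBy x (f ⊕ g) ≈ (shiftBy x f ⊕ shiftBy x g)
  shiftBy-⊕ (mono c p q r) f g n a b with p ≤ᵇ n | q ≤ᵇ a | r ≤ᵇ b
  ... | false | _     | _     = refl
  ... | true  | false | _     = refl
  ... | true  | true  | false = refl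
  ... | true  | true  | true  = *-distribʳ-+ c (f (n ∸ p) (a ∸ q) (b ∸ r)) _

  shiftBy-𝟘 : ∀ x → shiftBy x 𝟘 ≈ 𝟘
  shiftBy-𝟘 (mono c p q r) n a b with p ≤ᵇ n | q ≤ᵇ a | r ≤ᵇ b
  ... | false | _     | _     = refl
  ... | true  | false | _     = refl
  ... | true  | true  | false = refl
  ... | true  | true  | true  = refl

  ⟦⟧-++ : ∀ P Q → ⟦ P ++ Q ⟧ ≈ (⟦ P ⟧ ⊕ ⟦ Q ⟧)
  ⟦⟧-++ []      Q n a b = sym (+-identityˡ _)
  ⟦⟧-++ (x ∷ P) Q n a b = trans (cong (λ s → ⟦ x ⟧ₘ n a b + s) (⟦⟧-++ P Q n a b))
                                (sym (+-assoc (⟦ x ⟧ₘ n a b) (⟦ P ⟧ n a b) (⟦ Q ⟧ n a b)))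

  shiftBy-poly : ∀ x P → shiftBy x ⟦ P ⟧ ≈ ⟦ map (x ·ₘ_) P ⟧
  shiftBy-poly x []      = shiftBy-𝟘 x
  shiftBy-poly x (y ∷ P) n a b =
    trans (shiftBy-⊕ x ⟦ y ⟧ₘ ⟦ P ⟧ n a b) (cong₂ _+_ (shiftBy-monomial x y n a b) (shiftBy-poly x P n a b))

  shiftByPoly-poly : ∀ P Q → shiftByPoly Q ⟦ P ⟧ ≈ ⟦ P · Q ⟧
  shiftByPoly-poly P []      n a b = refl
  shiftByPoly-poly P (x ∷ Q) n a b =
    trans (cong₂ _+_ (shiftBy-poly x P n a b) (shiftByPoly-poly P Q n a b))
          (sym (⟦⟧-++ (map (x ·ₘ_) P) (P · Q) n a b))

  ⟦⟧-neg : ∀ P n a b → ⟦ map negₘ P ⟧ n a b ≡ - ⟦ P ⟧ n a b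
  ⟦⟧-neg []                   n a b = refl
  ⟦⟧-neg (mono c p q r ∷ P) n a b =
    trans (cong₂ _+_ (negate (n ≡ᵇ p) (a ≡ᵇ q) (b ≡ᵇ r)) (⟦⟧-neg P n a b))
          (sym (neg-distrib-+ (⟦ mono c p q r ⟧ₘ n a b) (⟦ P ⟧ n a b)))
    where
    negate : ∀ t₁ t₂ t₃ → (if t₁ then (if t₂ then (if t₃ then - c else + 0) else + 0) else + 0) ≡
                          - (if t₁ then (if t₂ then (if t₃ then c else + 0) else + 0) else + 0)
    negate false _     _     = refl
    negate true  false _     = refl
    negate true  true  false = refl
    negate true  true  true  = refl

  Expansion : FPS → Set
  Expansion f = Σ Poly λ P → f ≈ ⟦ P ⟧

  expand-T : Expansion T
  expand-T = mono (+ 1) 1 0 0 ∷ [] , λ where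
    zero          a       b       → refl
    (suc zero)    zero    zero    → refl
    (suc zero)    zero    (suc b) → refl
    (suc zero)    (suc a) b       → refl
    (suc (suc n)) a       b       → refl

  expand-U : Expansion U
  expand-U = mono (+ 1) 0 1 0 ∷ [] , λ where
    (suc n) a             b       → refl
    zero    zero          b       → refl
    zero    (suc zero)    zero    → refl
    zero    (suc zero)    (suc b) → refl
    zero    (suc (suc a)) b       → refl

  expand-V : Expansion V
  expand-V = mono (+ 1) 0 0 1 ∷ [] , λ where
    (suc n) a       b             → refl
    zero    (suc a) b             → refl
    zero    zero    zero          → refl
    zero    zero    (suc zero)    → refl
    zero    zero    (suc (suc b)) → refl

  expand-const : ∀ c → Expansion (const c)
  expand-const c = mono c 0 0 0 ∷ [] , λ where
    zero    zero    zero    → sym (+-identityʳ c)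
    zero    zero    (suc b) → refl
    zero    (suc a) b       → refl
    (suc n) a       b       → refl

  infixl 6 _⊕ᴱ_ _⊖ᴱ_
  infixl 7 _⊛ᴱ_

  _⊛ᴱ_ : ∀ {f g} → Expansion f → Expansion g → Expansion (f ⊛ g)
  (P , f≈P) ⊛ᴱ (Q , g≈Q) = P · Q ,
    ≈-trans (⊛-cong f≈P g≈Q) (≈-trans (⊛-poly ⟦ P ⟧ Q) (shiftByPoly-poly P Q))

  _⊕ᴱ_ : ∀ {f g} → Expansion f → Expansion g → Expansion (f ⊕ g)
  (P , f≈P) ⊕ᴱ (Q , g≈Q) = P ++ Q , λ n a b →
    trans (cong₂ _+_ (f≈P n a b) (g≈Q n a b)) (sym (⟦⟧-++ P Q n a b))

  _⊖ᴱ_ : ∀ {f g} → Expansion f → Expansion g → Expansion (f ⊖ g)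
  (P , f≈P) ⊖ᴱ (Q , g≈Q) = P ++ map negₘ Q , λ n a b →
    trans (cong₂ _-_ (f≈P n a b) (g≈Q n a b))
          (trans (cong (λ s → ⟦ P ⟧ n a b + s) (sym (⟦⟧-neg Q n a b))) (sym (⟦⟧-++ P (map negₘ Q) n a b)))

  expand-numerator : Expansion numerator
  expand-numerator = expand-T ⊛ᴱ expand-U ⊛ᴱ expand-U ⊛ᴱ expand-V ⊛ᴱ
    ( expand-const (+ 1)
    ⊕ᴱ (expand-V ⊖ᴱ expand-const (+ 3)) ⊛ᴱ expand-T
    ⊕ᴱ (expand-const (+ 1) ⊕ᴱ expand-U ⊖ᴱ expand-V ⊖ᴱ expand-U ⊛ᴱ expand-V ⊕ᴱ expand-V ⊛ᴱ expand-V)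
         ⊛ᴱ expand-T ⊛ᴱ expand-T
    ⊕ᴱ expand-U ⊛ᴱ expand-V ⊛ᴱ (expand-const (+ 1) ⊖ᴱ expand-V) ⊛ᴱ expand-T ⊛ᴱ expand-T ⊛ᴱ expand-T )

  expand-denominator : Expansion denominator
  expand-denominator =
    (expand-const (+ 1) ⊖ᴱ expand-const (+ 3) ⊛ᴱ expand-T ⊕ᴱ expand-T ⊛ᴱ expand-T)
    ⊛ᴱ (expand-const (+ 1) ⊖ᴱ expand-T ⊛ᴱ expand-U)

  SupportedIn : ℕ → ℕ → ℕ → FPS → Set
  SupportedIn N A B f = ∀ n a b → n ≤ N → A ≤ a ⊎ B ≤ b → f n a b ≡ + 0

  DegreesBelow : ℕ → ℕ → Poly → Set
  DegreesBelow A B = All λ x → Monomial.udeg x < A × Monomial.vdeg x < B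

  poly-supported : ∀ N A B P → DegreesBelow A B P → SupportedIn N A B ⟦ P ⟧
  poly-supported N A B []                   []                   n a b _ _   = refl
  poly-supported N A B (mono c p q r ∷ P) ((q<A , r<B) ∷ degs) n a b n≤N out =
    cong₂ _+_ (monomial out) (poly-supported N A B P degs n a b n≤N out)
    where
    monomial : A ≤ a ⊎ B ≤ b → ⟦ mono c p q r ⟧ₘ n a b ≡ + 0
    monomial (inj₁ A≤a) rewrite ≡ᵇ-false a q (λ a≡q → <⇒≢ (<-≤-trans q<A A≤a) (sym a≡q)) =
      if-same (n ℕ.≡ᵇ p) (+ 0)
    monomial (inj₂ B≤b) rewrite ≡ᵇ-false b r (λ b≡r → <⇒≢ (<-≤-trans r<B B≤b) (sym b≡r)) =
      trans (cong (λ y → if n ℕ.≡ᵇ p then y else + 0) (if-same (a ℕ.≡ᵇ q) (+ 0))) (if-same (n ℕ.≡ᵇ p) (+ 0))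

  shiftByPoly-supported : ∀ N A B D E f Q → DegreesBelow (suc D) (suc E) Q → SupportedIn N A B f →
                          SupportedIn N (D ℕ.+ A) (E ℕ.+ B) (shiftByPoly Q f)
  shiftByPoly-supported N A B D E f []                   []                   supp n a b _ _ = refl
  shiftByPoly-supported N A B D E f (mono c p q r ∷ Q) ((s≤s q≤D , s≤s r≤E) ∷ degs) supp n a b n≤N out =
    cong₂ _+_ monomial (shiftByPoly-supported N A B D E f Q degs supp n a b n≤N out)
    where
    lower : ∀ {A D a q} → q ≤ D → D ℕ.+ A ≤ a → A ≤ a ℕ.∸ q
    lower {A} {D} {a} {q} q≤D DA≤a =
      ≤-trans (m≤n+m A (D ℕ.∸ q)) (subst (_≤ a ℕ.∸ q) (+-∸-comm A q≤D) (∸-monoˡ-≤ q DA≤a))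
    out′ : A ≤ a ℕ.∸ q ⊎ B ≤ b ℕ.∸ r
    out′ = Sum.map (lower q≤D) (lower r≤E) out
    monomial : shiftBy (mono c p q r) f n a b ≡ + 0
    monomial with p ℕ.≤ᵇ n | q ℕ.≤ᵇ a | r ℕ.≤ᵇ b
    ... | false | _     | _     = refl
    ... | true  | false | _     = refl
    ... | true  | true  | false = refl
    ... | true  | true  | true  rewrite supp (n ℕ.∸ p) (a ℕ.∸ q) (b ℕ.∸ r) (≤-trans (m∸n≤m n p) n≤N) out′ = refl

  agree-on-box : ∀ N A B {f g} → SupportedIn N A B f → SupportedIn N A B g →
    (∀ {n} → n < suc N → ∀ {a} → a < A → ∀ {b} → b < B → f n a b ≡ g n a b) →
    ∀ n a b → n ≤ N → f n a b ≡ g n a b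
  agree-on-box N A B f-supp g-supp box n a b n≤N with A ≤? a | B ≤? b
  ... | yes A≤a | _      = trans (f-supp n a b n≤N (inj₁ A≤a)) (sym (g-supp n a b n≤N (inj₁ A≤a)))
  ... | no  _   | yes B≤b = trans (f-supp n a b n≤N (inj₂ B≤b)) (sym (g-supp n a b n≤N (inj₂ B≤b)))
  ... | no  a≮A | no b≮B = box (s≤s n≤N) (ℕₚ.≰⇒> a≮A) (ℕₚ.≰⇒> b≮B)

open Permutations using (h; corr; second-difference; corr-suc; H-count; h-outside)
open PowerSeries

open import Data.Integer as ℤ using (ℤ; +_; -[1+_]; _+_; _*_; _-_)
open import Data.Integer.Properties using (pos-+; +-inverseʳ; +-identityˡ)
open import Data.Integer.Tactic.RingSolver using (solve-∀)
open import Data.List.Relation.Unary.All as All using ()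
open import Data.Nat as ℕ using (ℕ; zero; suc; _≤_; _<_; z≤n; s≤s)
open import Data.Nat.Properties as ℕₚ using (≤-<-trans; <-≤-trans; _≤?_; allUpTo?)
open import Data.Product using (∃; _,_; proj₁; proj₂)
open import Data.Sum using (_⊎_; inj₁; inj₂)
open import Relation.Binary.PropositionalEquality
open import Relation.Nullary using (yes; no)
open import Relation.Nullary.Decidable using (toWitness; _×-dec_)

lift : ∀ x y z u v w → x ℕ.+ y ℕ.+ (w ℕ.+ w) ≡ z ℕ.+ z ℕ.+ z ℕ.+ u ℕ.+ v →
       + x - + 3 * + z + + y ≡ + u - + 2 * + w + + v
lift x y z u v w eq = begin
  + x - + 3 * + z + + y
    ≡⟨ rearrange (+ x) (+ y) (+ z) (+ u) (+ v) (+ w) ⟩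
  (+ x + + y + (+ w + + w)) - (+ z + + z + + z + + u + + v) + (+ u - + 2 * + w + + v)
    ≡⟨ cong (λ d → d + (+ u - + 2 * + w + + v)) difference-zero ⟩
  + 0 + (+ u - + 2 * + w + + v)
    ≡⟨ +-identityˡ _ ⟩
  + u - + 2 * + w + + v ∎
  where
  open ≡-Reasoning
  rearrange : ∀ x y z u v w → x - + 3 * z + y ≡
              (x + y + (w + w)) - (z + z + z + u + v) + (u - + 2 * w + v)
  rearrange = solve-∀
  L R : ℕ
  L = x ℕ.+ y ℕ.+ (w ℕ.+ w)
  R = z ℕ.+ z ℕ.+ z ℕ.+ u ℕ.+ v
  embed-L : + L ≡ + x + + y + (+ w + + w)
  embed-L = trans (pos-+ (x ℕ.+ y) (w ℕ.+ w)) (cong₂ _+_ (pos-+ x y) (pos-+ w w))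
  embed-R : + R ≡ + z + + z + + z + + u + + v
  embed-R = trans (pos-+ _ v) (cong (_+ + v) (trans (pos-+ _ u) (cong (_+ + u)
              (trans (pos-+ _ z) (cong (_+ + z) (pos-+ z z))))))
  difference-zero : (+ x + + y + (+ w + + w)) - (+ z + + z + + z + + u + + v) ≡ + 0
  difference-zero = begin
    (+ x + + y + (+ w + + w)) - (+ z + + z + + z + + u + + v) ≡⟨ cong₂ _-_ (sym embed-L) (sym embed-R) ⟩
    + L - + R                                                   ≡⟨ cong (λ t → + t - + R) eq ⟩
    + R - + R                                                   ≡⟨ +-inverseʳ (+ R) ⟩
    + 0                                                         ∎

Δ : ℕ → ℕ → ℕ → ℤ
Δ n a b = H (2 ℕ.+ n) a b - + 3 * H (1 ℕ.+ n) a b + H n a b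

corrections : ℕ → ℕ → ℕ → ℤ
corrections n a b = + corr n a b 1 - + 2 * + corr n a b 2 + + corr n a b 3

Δ≡corrections : ∀ n → 3 ≤ n → ∀ a b → Δ n a b ≡ corrections n a b
Δ≡corrections (suc n) 3≤n a b =
  trans (cong₂ (λ x z → x - + 3 * z + H (suc n) a b) (H-count (2 ℕ.+ n) a b) (H-count (1 ℕ.+ n) a b))
  (trans (cong (λ y → + h (3 ℕ.+ n) a b - + 3 * + h (2 ℕ.+ n) a b + y) (H-count n a b))
         (lift (h (3 ℕ.+ n) a b) (h (suc n) a b) (h (2 ℕ.+ n) a b)
               (corr (suc n) a b 1) (corr (suc n) a b 3) (corr (suc n) a b 2)
               (second-difference (suc n) 3≤n a b)))

corrections-shift : ∀ n → 3 ≤ n → ∀ a b → corrections (suc n) (suc a) b ≡ corrections n a b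
corrections-shift n 3≤n a b =
  cong₂ (λ x y → x + + y)
        (cong₂ (λ x y → + x - + 2 * + y) (corr-suc n 3≤n (suc a) b 1) (corr-suc n 3≤n (suc a) b 2))
        (corr-suc n 3≤n (suc a) b 3)

corrections-zero : ∀ n b → corrections n 0 b ≡ + 0
corrections-zero n b = refl

numeratorPoly denominatorPoly : Poly
numeratorPoly   = proj₁ expand-numerator
denominatorPoly = proj₁ expand-denominator

H⊛denominator : (H ⊛ denominator) ≈ shiftByPoly denominatorPoly H
H⊛denominator =
  ≈-trans (⊛-cong {H} {H} (λ _ _ _ → refl) (proj₂ expand-denominator)) (⊛-poly H denominatorPoly)

coefficient-suc : ∀ n a b →
  shiftByPoly denominatorPoly H (3 ℕ.+ n) (suc a) b ≡ Δ (1 ℕ.+ n) (suc a) b - Δ n a b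
coefficient-suc n a b = expand (H (3 ℕ.+ n) (suc a) b) (H (2 ℕ.+ n) (suc a) b) (H (1 ℕ.+ n) (suc a) b)
                               (H (2 ℕ.+ n) a b) (H (1 ℕ.+ n) a b) (H n a b)
  where
  expand : ∀ x y z u v w →
    x * + 1 + (y * -[1+ 2 ] + (z * + 1 + (u * -[1+ 0 ] + (v * + 3 + (w * -[1+ 0 ] + + 0))))) ≡
    (x - + 3 * y + z) - (u - + 3 * v + w)
  expand = solve-∀

coefficient-zero : ∀ n b → shiftByPoly denominatorPoly H (3 ℕ.+ n) 0 b ≡ Δ (1 ℕ.+ n) 0 b
coefficient-zero n b = expand (H (3 ℕ.+ n) 0 b) (H (2 ℕ.+ n) 0 b) (H (1 ℕ.+ n) 0 b)
  where
  expand : ∀ x y z → x * + 1 + (y * -[1+ 2 ] + (z * + 1 + (+ 0 + (+ 0 + (+ 0 + + 0))))) ≡ x - + 3 * y + z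
  expand = solve-∀

large-coefficients : ∀ n a b → (H ⊛ denominator) (6 ℕ.+ n) a b ≡ + 0
large-coefficients n zero b = begin
  (H ⊛ denominator) (6 ℕ.+ n) 0 b             ≡⟨ H⊛denominator (6 ℕ.+ n) 0 b ⟩
  shiftByPoly denominatorPoly H (6 ℕ.+ n) 0 b ≡⟨ coefficient-zero (3 ℕ.+ n) b ⟩
  Δ (4 ℕ.+ n) 0 b                              ≡⟨ Δ≡corrections (4 ℕ.+ n) (s≤s (s≤s (s≤s z≤n))) 0 b ⟩
  corrections (4 ℕ.+ n) 0 b                    ≡⟨ corrections-zero (4 ℕ.+ n) b ⟩
  + 0                                          ∎
  where open ≡-Reasoning
large-coefficients n (suc a) b = begin
  (H ⊛ denominator) (6 ℕ.+ n) (suc a) b             ≡⟨ H⊛denominator (6 ℕ.+ n) (suc a) b ⟩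
  shiftByPoly denominatorPoly H (6 ℕ.+ n) (suc a) b ≡⟨ coefficient-suc (3 ℕ.+ n) a b ⟩
  Δ (4 ℕ.+ n) (suc a) b - Δ (3 ℕ.+ n) a b            ≡⟨ cong₂ _-_ (Δ≡corrections (4 ℕ.+ n) 3≤ (suc a) b)
                                                                   (Δ≡corrections (3 ℕ.+ n) 3≤ a b) ⟩
  corrections (4 ℕ.+ n) (suc a) b - corrections (3 ℕ.+ n) a b
                                                     ≡⟨ cong (_- corrections (3 ℕ.+ n) a b)
                                                             (corrections-shift (3 ℕ.+ n) 3≤ a b) ⟩
  corrections (3 ℕ.+ n) a b - corrections (3 ℕ.+ n) a b
                                                     ≡⟨ +-inverseʳ (corrections (3 ℕ.+ n) a b) ⟩
  + 0                                                ∎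
  where
  open ≡-Reasoning
  3≤ : ∀ {k} → 3 ≤ 3 ℕ.+ k
  3≤ = s≤s (s≤s (s≤s z≤n))

numerator-large : ∀ n a b → numerator (6 ℕ.+ n) a b ≡ + 0
numerator-large n a b = proj₂ expand-numerator (6 ℕ.+ n) a b

-- Coefficients of H: m(π) ≤ n + 1 and πₙ ≤ n.
H-supported : ∀ N → SupportedIn N (2 ℕ.+ N) (1 ℕ.+ N) H
H-supported N zero    a b _   _   = refl
H-supported N (suc n) a b n<N out = trans (H-count n a b) (cong +_ (h-outside (suc n) a b (bound out)))
  where
  bound : 2 ℕ.+ N ≤ a ⊎ 1 ℕ.+ N ≤ b → suc (suc n) < a ⊎ suc n < b
  bound (inj₁ A≤a) = inj₁ (≤-<-trans (s≤s n<N) A≤a)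
  bound (inj₂ B≤b) = inj₂ (<-≤-trans (s≤s n<N) B≤b)

initial-box : ∀ {n} → n < 6 → ∀ {a} → a < 8 → ∀ {b} → b < 6 →
              shiftByPoly denominatorPoly H n a b ≡ ⟦ numeratorPoly ⟧ n a b
initial-box = toWitness {a? = allUpTo? (λ n → allUpTo? (λ a → allUpTo? (λ b →
                shiftByPoly denominatorPoly H n a b ℤ.≟ ⟦ numeratorPoly ⟧ n a b) 6) 8) 6} _

initial-coefficients : ∀ n → n ≤ 5 → ∀ a b → (H ⊛ denominator) n a b ≡ numerator n a b
initial-coefficients n n≤5 a b = begin
  (H ⊛ denominator) n a b               ≡⟨ H⊛denominator n a b ⟩
  shiftByPoly denominatorPoly H n a b
    ≡⟨ agree-on-box 5 8 6 lhs-supported rhs-supported initial-box n a b n≤5 ⟩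
  ⟦ numeratorPoly ⟧ n a b                ≡⟨ sym (proj₂ expand-numerator n a b) ⟩
  numerator n a b                        ∎
  where
  open ≡-Reasoning
  -- the denominator has u-degree ≤ 1 and v-degree 0; the numerator stays inside the box
  lhs-supported : SupportedIn 5 8 6 (shiftByPoly denominatorPoly H)
  lhs-supported = shiftByPoly-supported 5 7 6 1 0 H denominatorPoly
    (toWitness {a? = All.all? (λ x → Monomial.udeg x ℕₚ.<? 2 ×-dec Monomial.vdeg x ℕₚ.<? 1) denominatorPoly} _)
    (H-supported 5)
  rhs-supported : SupportedIn 5 8 6 ⟦ numeratorPoly ⟧
  rhs-supported = poly-supported 5 8 6 numeratorPoly
    (toWitness {a? = All.all? (λ x → Monomial.udeg x ℕₚ.<? 8 ×-dec Monomial.vdeg x ℕₚ.<? 6) numeratorPoly} _)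

small-or-large : ∀ n → n ≤ 5 ⊎ ∃ λ k → n ≡ 6 ℕ.+ k
small-or-large n with n ≤? 5
... | yes n≤5 = inj₁ n≤5
... | no  n≰5 = inj₂ (n ℕ.∸ 6 , sym (ℕₚ.m+[n∸m]≡n (ℕₚ.≰⇒> n≰5)))

-- H = numerator / denominator: small t-degrees by computation, the rest by the recurrence.
-- (The case split goes through a helper rather than 'with', which would normalise the goal.)
proposition3p9 : (H ⊛ denominator) ≈ numerator
proposition3p9 n a b = by-size (small-or-large n)
  where
  by-size : n ≤ 5 ⊎ ∃ (λ k → n ≡ 6 ℕ.+ k) → (H ⊛ denominator) n a b ≡ numerator n a b
  by-size (inj₁ n≤5)         = initial-coefficients n n≤5 a b
  by-size (inj₂ (k , n≡6+k)) = subst (λ n → (H ⊛ denominator) n a b ≡ numerator n a b) (sym n≡6+k)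
                                 (trans (large-coefficients k a b) (sym (numerator-large k a b)))
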